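{- Let $F$ be a forest on $n$ vertices with $3\mid e(F)$ that contains a switching structure and a generalized switching structure which are vertex-disjoint, where either (1) $n\ge 7$ and the generalized structure is of degree $2$, or (2) $n\ge 9$ and the generalized structure is of degree $3$. Let $\chi:E(K_n)\to\mathbb{Z}_3$ be a coloring with $\alpha_{C_4}(\chi)\ge 1$ such that there is an alternating $4$-cycle $C$ for which the coloring restricted to $K_n-V(C)$ is not monochromatic. Then $K_n$ contains a copy of $F$ whose edge colors sum to $0$ in $\mathbb{Z}_3$.
   Context: In a forest, the unique neighbor of a leaf is its parent. A switching structure is a quadruple of distinct vertices $(v_1,v_2,v_3,v_4)$ such that either $v_1v_2v_3v_4$ is a path with $v_2,v_3$ of degree exactly $2$, or $v_1,v_4$ are parents of leaves $v_2,v_3$ respectively. A degree $2$ generalized switching structure $(l,u)_2$: $u$ is a vertex of degree $2$ whose neighbors are some vertex $v$ and either a leaf $l$, or a vertex $p$ which is the parent of a leaf $l$; its vertices are $l$ and $u$ only ($v$ and $p$ are not counted). A degree $3$ generalized switching structure $(l,u,v,w)_3$: $u$ is a vertex of degree $3$ whose neighbors are $v,w$ and either a leaf $l$, or a vertex $p$ which is the parent of a leaf $l$; its vertices are $l,u,v,w$ ($p$ is not counted). For a $\mathbb{Z}_3$-coloring $\chi$ of a complete graph, a $4$-cycle is alternating if the sums of the colors on its two perfect matchings are distinct, and $\alpha_{C_4}(\chi)$ is the maximum number of pairwise vertex-disjoint alternating $4$-cycles. -}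

module Defs where

open import Data.Bool using (Bool; true; false; if_then_else_; _∧_)
open import Data.Nat using (ℕ; zero; suc; _+_; _≤_; _<ᵇ_; _%_)
open import Data.Nat.Divisibility using (_∣_)
open import Data.Fin using (Fin; toℕ; inject₁; fromℕ) renaming (zero to fzero; suc to fsuc)
open import Data.List using (List; map; allFin)
open import Data.Nat.ListAction using (sum)
open import Data.Product using (Σ; ∃; ∃-syntax; _×_; _,_)
open import Data.Sum using (_⊎_)
open import Relation.Binary.PropositionalEquality using (_≡_; _≢_)
open import Relation.Nullary using (¬_)
open import Function.Definitions using (Injective)

record Graph (n : ℕ) : Set where
  field
    adj   : Fin n → Fin n → Bool
    sym   : ∀ i j → adj i j ≡ adj j i
    irrefl : ∀ i → adj i i ≡ false
open Graph public

Adj : ∀ {n} → Graph n → Fin n → Fin n → Set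
Adj G i j = adj G i j ≡ true

Σv : ∀ {n} → (Fin n → ℕ) → ℕ
Σv {n} f = sum (map f (allFin n))

bit : Bool → ℕ
bit b = if b then 1 else 0

degree : ∀ {n} → Graph n → Fin n → ℕ
degree G i = Σv (λ j → bit (adj G i j))

edgeCount : ∀ {n} → Graph n → ℕ
edgeCount G = Σv (λ i → Σv (λ j → bit (adj G i j ∧ (toℕ i <ᵇ toℕ j))))

IsCycle : ∀ {n} → Graph n → (k : ℕ) → (Fin (3 + k) → Fin n) → Set
IsCycle G k f =
  Injective _≡_ _≡_ f
  × (∀ (i : Fin (2 + k)) → Adj G (f (inject₁ i)) (f (fsuc i)))
  × Adj G (f (fromℕ (2 + k))) (f fzero)

IsForest : ∀ {n} → Graph n → Set
IsForest G = ∀ k f → ¬ IsCycle G k f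

Leaf : ∀ {n} → Graph n → Fin n → Set
Leaf G l = degree G l ≡ 1

ParentOfLeaf : ∀ {n} → Graph n → Fin n → Fin n → Set
ParentOfLeaf G p l = Leaf G l × Adj G p l

Distinct4 : ∀ {n} → Fin n → Fin n → Fin n → Fin n → Set
Distinct4 a b c d = a ≢ b × a ≢ c × a ≢ d × b ≢ c × b ≢ d × c ≢ d

SwitchingStructure : ∀ {n} → Graph n → Fin n → Fin n → Fin n → Fin n → Set
SwitchingStructure G v₁ v₂ v₃ v₄ =
  Distinct4 v₁ v₂ v₃ v₄ ×
  ( (Adj G v₁ v₂ × Adj G v₂ v₃ × Adj G v₃ v₄ × degree G v₂ ≡ 2 × degree G v₃ ≡ 2)
  ⊎ (ParentOfLeaf G v₁ v₂ × ParentOfLeaf G v₄ v₃) )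

LeafSide : ∀ {n} → Graph n → Fin n → Fin n → Fin n → Set
LeafSide G u x l = Adj G u x × ((x ≡ l × Leaf G l) ⊎ ParentOfLeaf G x l)

-- degree 2 generalized switching structure (l,u)_2; its vertices are l and u
GenSwitching2 : ∀ {n} → Graph n → Fin n → Fin n → Set
GenSwitching2 G l u =
  degree G u ≡ 2 ×
  ∃[ v ] ∃[ x ] (x ≢ v × Adj G u v × LeafSide G u x l)

-- degree 3 generalized switching structure (l,u,v,w)_3; its vertices are l,u,v,w
GenSwitching3 : ∀ {n} → Graph n → Fin n → Fin n → Fin n → Fin n → Set
GenSwitching3 G l u v w =
  degree G u ≡ 3 × Adj G u v × Adj G u w × v ≢ w ×
  ∃[ x ] (x ≢ v × x ≢ w × LeafSide G u x l)

NotIn4 : ∀ {n} → Fin n → Fin n → Fin n → Fin n → Fin n → Set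
NotIn4 a b₁ b₂ b₃ b₄ = a ≢ b₁ × a ≢ b₂ × a ≢ b₃ × a ≢ b₄

HasCase1 : ∀ {n} → Graph n → Set
HasCase1 G = ∃[ v₁ ] ∃[ v₂ ] ∃[ v₃ ] ∃[ v₄ ] ∃[ l ] ∃[ u ]
  (SwitchingStructure G v₁ v₂ v₃ v₄ × GenSwitching2 G l u
   × NotIn4 l v₁ v₂ v₃ v₄ × NotIn4 u v₁ v₂ v₃ v₄)

HasCase2 : ∀ {n} → Graph n → Set
HasCase2 G = ∃[ v₁ ] ∃[ v₂ ] ∃[ v₃ ] ∃[ v₄ ] ∃[ l ] ∃[ u ] ∃[ v ] ∃[ w ]
  (SwitchingStructure G v₁ v₂ v₃ v₄ × GenSwitching3 G l u v w
   × NotIn4 l v₁ v₂ v₃ v₄ × NotIn4 u v₁ v₂ v₃ v₄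
   × NotIn4 v v₁ v₂ v₃ v₄ × NotIn4 w v₁ v₂ v₃ v₄)

-- Z₃-colourings of E(K_n): symmetric functions on pairs (diagonal irrelevant)
Coloring : ℕ → Set
Coloring n = Fin n → Fin n → Fin 3

SymColoring : ∀ {n} → Coloring n → Set
SymColoring χ = ∀ i j → χ i j ≡ χ j i

Alternating : ∀ {n} → Coloring n → Fin n → Fin n → Fin n → Fin n → Set
Alternating χ a b c d =
  Distinct4 a b c d ×
  ((toℕ (χ a b) + toℕ (χ c d)) % 3 ≢ (toℕ (χ b c) + toℕ (χ d a)) % 3)

AlphaC4≥1 : ∀ {n} → Coloring n → Set
AlphaC4≥1 χ = ∃[ a ] ∃[ b ] ∃[ c ] ∃[ d ] Alternating χ a b c d

NotMonoOutside : ∀ {n} → Coloring n → Fin n → Fin n → Fin n → Fin n → Set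
NotMonoOutside χ a b c d = ∃[ x ] ∃[ y ] ∃[ z ] ∃[ t ]
  (x ≢ y × z ≢ t × NotIn4 x a b c d × NotIn4 y a b c d
   × NotIn4 z a b c d × NotIn4 t a b c d × χ x y ≢ χ z t)

copyColorSum : ∀ {n} → Graph n → Coloring n → (Fin n → Fin n) → ℕ
copyColorSum G χ φ =
  Σv (λ i → Σv (λ j → if adj G i j ∧ (toℕ i <ᵇ toℕ j) then toℕ (χ (φ i) (φ j)) else 0))

HasZeroSumCopy : ∀ {n} → Graph n → Coloring n → Set
HasZeroSumCopy G χ = ∃[ φ ] (Injective _≡_ _≡_ φ × copyColorSum G χ φ % 3 ≡ 0)

{-# OPTIONS --safe #-}
module Submission where

-- Transposing the images of two vertices p, q in a copy φ of F changes the colour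
-- sum only through the edges at p and q.  Transposing the inner vertices v₂, v₃ of
-- the switching structure trades the edges v₁v₂, v₃v₄ for v₁v₃, v₂v₄; transposing u
-- and l in the generalized structure trades the edges from u to its other
-- neighbours for edges from l to them.  We place the switching structure on an
-- alternating 4-cycle and the generalized one around a vertex y seeing two colours
-- (in the degree 3 case: around a suitable pair among y and two fresh vertices), so
-- that both trades change the colour sum by nonzero amounts h, g ∈ ℤ₃.  The two
-- transpositions do not interfere, so the four copies they generate have colour
-- sums s, s + h, s + g, s + h + g, and one of these is 0 in ℤ₃.

open import Defs hiding (sym)
open import Data.Nat using (ℕ; suc; _+_; _*_; _%_; _≤_; _<_; _<ᵇ_; _≥_)
open import Data.Nat.Divisibility using (_∣_)
open import Data.Product using (∃; ∃-syntax; _×_; _,_; proj₁; proj₂)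
open import Data.Sum as Sum using (_⊎_; inj₁; inj₂; [_,_])

open import Data.Bool using (true; false; if_then_else_; _∧_)
open import Data.Bool.Properties using (¬-not)
open import Data.Fin using (Fin; zero; suc; toℕ; _≟_)
open import Data.Fin.Patterns using (0F; 1F; 2F)
open import Data.Fin.Permutation.Components using (transpose; transpose-inverse)
open import Data.Fin.Properties using (toℕ-injective; toℕ<n; toℕ-fromℕ<; all?; ¬∀⟶∃¬; pigeonhole; <⇒≢)
open import Data.List using (List; []; _∷_; _++_; map; length; lookup)
open import Data.List.Membership.Propositional using (_∈_; _∉_)
open import Data.List.Properties using (map-tabulate; map-++)
open import Data.List.Relation.Unary.All as All using (All; []; _∷_)
open import Data.List.Relation.Unary.All.Properties using (¬Any⇒All¬; ++⁻)
open import Data.List.Relation.Unary.AllPairs using ([]; _∷_)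
open import Data.List.Relation.Unary.Any using (here; there; any?; index)
open import Data.List.Relation.Unary.Any.Properties using (lookup-index)
open import Data.List.Relation.Unary.Unique.Propositional using (Unique)
open import Data.List.Relation.Unary.Unique.Propositional.Properties using (++⁺; Unique[x∷xs]⇒x∉xs)
import Data.Nat.ListAction as ListAction
open import Data.Nat.DivMod using (_mod_; %-distribˡ-+; [m+kn]%n≡m%n; m%n%n≡m%n; m%n<n; m<n⇒m%n≡m)
open import Data.Nat.Properties
  using (+-assoc; +-comm; +-identityʳ; +-cancelʳ-≡; *-cancelʳ-≡; m≤m+n; n≮n; n≤1+n; ≤-trans; <-asym; ≮⇒≥;
         ≤-antisym; <ᵇ-reflects-<; module ≤-Reasoning)
import Data.Nat.Properties as ℕ
open import Algebra.Properties.CommutativeMonoid.Sum ℕ.+-0-commutativeMonoid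
  using (sum; sum-cong-≗; ∑-distrib-+; ∑-comm; sum-replicate-zero)
open import Algebra.Properties.CommutativeSemigroup ℕ.+-commutativeSemigroup
  using (x∙yz≈y∙xz; xy∙z≈z∙yx; interchange)
open import Data.Nat.Solver using (module +-*-Solver)
open import Data.Vec.Functional using (updateAt)
open import Data.Vec.Functional.Properties using (updateAt-updates; updateAt-minimal)
open import Function using (_∘_; id; const)
open import Function.Definitions using (Injective)
open import Relation.Binary.PropositionalEquality
  using (_≡_; _≢_; refl; sym; trans; cong; cong₂; subst; subst₂; module ≡-Reasoning)
open import Relation.Binary.Bundles using (Setoid)
open import Level using (0ℓ)
import Relation.Binary.Reasoning.Setoid as SetoidReasoning
open import Relation.Nullary using (¬_; Dec; yes; no; contradiction)
open import Relation.Nullary.Decidable using (map′; dec-true; dec-false)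
open import Relation.Nullary.Reflects using (ofʸ; ofⁿ)

open +-*-Solver using (solve; _:+_; _:*_; _:=_; con)

private
  variable
    n : ℕ
    A : Set

-- Residues modulo 3

infix 4 _≡₃_ _≟₃_

record _≡₃_ (m n : ℕ) : Set where
  constructor mod₃
  field
    residues : m % 3 ≡ n % 3

open _≡₃_

≡₃-refl : ∀ {m} → m ≡₃ m
≡₃-refl = mod₃ refl

≡₃-sym : ∀ {m n} → m ≡₃ n → n ≡₃ m
≡₃-sym (mod₃ e) = mod₃ (sym e)

≡₃-trans : ∀ {m n o} → m ≡₃ n → n ≡₃ o → m ≡₃ o
≡₃-trans (mod₃ e) (mod₃ f) = mod₃ (trans e f)

≡₃-setoid : Setoid 0ℓ 0ℓ
≡₃-setoid = record
  { Carrier = ℕ ; _≈_ = _≡₃_ ; isEquivalence = record { refl = ≡₃-refl ; sym = ≡₃-sym ; trans = ≡₃-trans } }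

module ≡₃-Reasoning = SetoidReasoning ≡₃-setoid

_≟₃_ : ∀ m n → Dec (m ≡₃ n)
m ≟₃ n = map′ mod₃ residues (m % 3 ℕ.≟ n % 3)

+-cong-≡₃ : ∀ {a b c d} → a ≡₃ b → c ≡₃ d → a + c ≡₃ b + d
+-cong-≡₃ {a} {b} {c} {d} (mod₃ a≡b) (mod₃ c≡d) = mod₃ (begin
  (a + c) % 3           ≡⟨ %-distribˡ-+ a c 3 ⟩
  (a % 3 + c % 3) % 3   ≡⟨ cong₂ (λ x y → (x + y) % 3) a≡b c≡d ⟩
  (b % 3 + d % 3) % 3   ≡⟨ %-distribˡ-+ b d 3 ⟨
  (b + d) % 3           ∎)
  where open ≡-Reasoning

m+k*3≡₃m : ∀ m k → m + k * 3 ≡₃ m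
m+k*3≡₃m m k = mod₃ ([m+kn]%n≡m%n m k 3)

+-cancelʳ-≡₃ : ∀ {x y} a → x + a ≡₃ y + a → x ≡₃ y
+-cancelʳ-≡₃ {x} {y} a e = begin
  x                 ≈⟨ m+k*3≡₃m x a ⟨
  x + a * 3         ≡⟨ regroup x a ⟩
  x + a + a * 2     ≈⟨ +-cong-≡₃ e ≡₃-refl ⟩
  y + a + a * 2     ≡⟨ regroup y a ⟨
  y + a * 3         ≈⟨ m+k*3≡₃m y a ⟩
  y                 ∎
  where
  open ≡₃-Reasoning
  regroup : ∀ z a → z + a * 3 ≡ z + a + a * 2
  regroup = solve 2 (λ z a → z :+ a :* con 3 := z :+ a :+ a :* con 2) refl

m+m≡₃n+n⇒m≡₃n : ∀ {m n} → m + m ≡₃ n + n → m ≡₃ n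
m+m≡₃n+n⇒m≡₃n {m} {n} e = begin
  m                     ≈⟨ m+k*3≡₃m m m ⟨
  m + m * 3             ≡⟨ quadruple m ⟩
  (m + m) + (m + m)     ≈⟨ +-cong-≡₃ e e ⟩
  (n + n) + (n + n)     ≡⟨ quadruple n ⟨
  n + n * 3             ≈⟨ m+k*3≡₃m n n ⟩
  n                     ∎
  where
  open ≡₃-Reasoning
  quadruple : ∀ z → z + z * 3 ≡ (z + z) + (z + z)
  quadruple = solve 1 (λ z → z :+ z :* con 3 := (z :+ z) :+ (z :+ z)) refl

-- b * 2 plays the role of -b in ℤ₃.
≡₃-shift : ∀ {x y a b} → x + a ≡ y + b → y ≡₃ x + (a + b * 2)
≡₃-shift {x} {y} {a} {b} e = begin
  y                     ≈⟨ m+k*3≡₃m y b ⟨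
  y + b * 3             ≡⟨ regroup y b ⟩
  y + b + b * 2         ≡⟨ cong (_+ b * 2) e ⟨
  x + a + b * 2         ≡⟨ +-assoc x a (b * 2) ⟩
  x + (a + b * 2)       ∎
  where
  open ≡₃-Reasoning
  regroup : ∀ y b → y + b * 3 ≡ y + b + b * 2
  regroup = solve 2 (λ y b → y :+ b :* con 3 := y :+ b :+ b :* con 2) refl

shift-≢₃0 : ∀ {a b} → ¬ a ≡₃ b → ¬ a + b * 2 ≡₃ 0
shift-≢₃0 {a} {b} a≢b e = a≢b (begin
  a                   ≈⟨ m+k*3≡₃m a b ⟨
  a + b * 3           ≡⟨ regroup a b ⟩
  a + b * 2 + b       ≈⟨ +-cong-≡₃ e ≡₃-refl ⟩
  b                   ∎)
  where
  open ≡₃-Reasoning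
  regroup : ∀ a b → a + b * 3 ≡ a + b * 2 + b
  regroup = solve 2 (λ a b → a :+ b :* con 3 := a :+ b :* con 2 :+ b) refl

≡₃-toℕ-mod : ∀ m → m ≡₃ toℕ (m mod 3)
≡₃-toℕ-mod m = mod₃ (trans (sym (m%n%n≡m%n m 3)) (cong (_% 3) (sym (toℕ-fromℕ< (m%n<n m 3)))))

toℕ-≡₃-injective : ∀ {a b : Fin 3} → toℕ a ≡₃ toℕ b → a ≡ b
toℕ-≡₃-injective {a} {b} (mod₃ e) =
  toℕ-injective (trans (sym (m<n⇒m%n≡m (toℕ<n a))) (trans e (m<n⇒m%n≡m (toℕ<n b))))

zero-among-shifts-Fin3 : ∀ (r h g : Fin 3) → h ≢ 0F → g ≢ 0F →
  toℕ r ≡₃ 0 ⊎ toℕ r + toℕ h ≡₃ 0 ⊎ toℕ r + toℕ g ≡₃ 0 ⊎ toℕ r + toℕ h + toℕ g ≡₃ 0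
zero-among-shifts-Fin3 _  0F _  h≢0 _   = contradiction refl h≢0
zero-among-shifts-Fin3 _  _  0F _   g≢0 = contradiction refl g≢0
zero-among-shifts-Fin3 0F _  _  _   _   = inj₁ (mod₃ refl)
zero-among-shifts-Fin3 1F 2F _  _   _   = inj₂ (inj₁ (mod₃ refl))
zero-among-shifts-Fin3 2F 1F _  _   _   = inj₂ (inj₁ (mod₃ refl))
zero-among-shifts-Fin3 1F 1F 2F _   _   = inj₂ (inj₂ (inj₁ (mod₃ refl)))
zero-among-shifts-Fin3 2F 2F 1F _   _   = inj₂ (inj₂ (inj₁ (mod₃ refl)))
zero-among-shifts-Fin3 1F 1F 1F _   _   = inj₂ (inj₂ (inj₂ (mod₃ refl)))
zero-among-shifts-Fin3 2F 2F 2F _   _   = inj₂ (inj₂ (inj₂ (mod₃ refl)))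

zero-among-shifts : ∀ s h g → ¬ h ≡₃ 0 → ¬ g ≡₃ 0 →
  s ≡₃ 0 ⊎ s + h ≡₃ 0 ⊎ s + g ≡₃ 0 ⊎ s + h + g ≡₃ 0
zero-among-shifts s h g h≢0 g≢0 =
  Sum.map (≡₃-trans rs) (Sum.map (≡₃-trans (+-cong-≡₃ rs rh)) (Sum.map (≡₃-trans (+-cong-≡₃ rs rg))
      (≡₃-trans (+-cong-≡₃ (+-cong-≡₃ rs rh) rg))))
    (zero-among-shifts-Fin3 (s mod 3) (h mod 3) (g mod 3) (mod-≢0F h≢0) (mod-≢0F g≢0))
  where
  rs : s ≡₃ toℕ (s mod 3)
  rs = ≡₃-toℕ-mod s
  rh : h ≡₃ toℕ (h mod 3)
  rh = ≡₃-toℕ-mod h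
  rg : g ≡₃ toℕ (g mod 3)
  rg = ≡₃-toℕ-mod g
  mod-≢0F : ∀ {m} → ¬ m ≡₃ 0 → m mod 3 ≢ 0F
  mod-≢0F {m} m≢0 e = m≢0 (≡₃-trans (≡₃-toℕ-mod m) (mod₃ (cong (λ r → toℕ r % 3) e)))

zero-residue-among-four : ∀ {s₀ s₁ s₂ s₃ a b c d} →
  s₀ + a ≡ s₁ + b → s₀ + c ≡ s₂ + d → s₁ + c ≡ s₃ + d → ¬ a ≡₃ b → ¬ c ≡₃ d →
  s₀ ≡₃ 0 ⊎ s₁ ≡₃ 0 ⊎ s₂ ≡₃ 0 ⊎ s₃ ≡₃ 0
zero-residue-among-four {s₀} {s₁} {s₂} {s₃} {a} {b} {c} {d} e₁ e₂ e₃ a≢b c≢d =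
  Sum.map₂ (Sum.map (≡₃-trans s₁≡) (Sum.map (≡₃-trans s₂≡) (≡₃-trans s₃≡)))
    (zero-among-shifts s₀ (a + b * 2) (c + d * 2) (shift-≢₃0 a≢b) (shift-≢₃0 c≢d))
  where
  s₁≡ : s₁ ≡₃ s₀ + (a + b * 2)
  s₁≡ = ≡₃-shift {s₀} {s₁} {a} {b} e₁
  s₂≡ : s₂ ≡₃ s₀ + (c + d * 2)
  s₂≡ = ≡₃-shift {s₀} {s₂} {c} {d} e₂
  s₃≡ : s₃ ≡₃ s₀ + (a + b * 2) + (c + d * 2)
  s₃≡ = ≡₃-trans (≡₃-shift {s₁} {s₃} {c} {d} e₃) (+-cong-≡₃ s₁≡ ≡₃-refl)

-- Sums over the vertex set

Σv-suc : (f : Fin (suc n) → ℕ) → Σv f ≡ f zero + Σv (f ∘ suc)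
Σv-suc f = cong (λ xs → f zero + ListAction.sum xs) (trans (map-tabulate suc f) (sym (map-tabulate id (f ∘ suc))))

Σv≡sum : (f : Fin n → ℕ) → Σv f ≡ sum f
Σv≡sum {ℕ.zero}  f = refl
Σv≡sum {suc n}   f = trans (Σv-suc f) (cong (f zero +_) (Σv≡sum (f ∘ suc)))

sumOver : List A → (A → ℕ) → ℕ
sumOver []      f = 0
sumOver (k ∷ K) f = f k + sumOver K f

sumOver-+ : ∀ K (f g : A → ℕ) → sumOver K (λ k → f k + g k) ≡ sumOver K f + sumOver K g
sumOver-+ []      f g = refl
sumOver-+ (k ∷ K) f g = trans (cong (f k + g k +_) (sumOver-+ K f g)) (interchange (f k) (g k) _ _)

sumOver-cong : ∀ K {f g : A → ℕ} → (∀ k → f k ≡ g k) → sumOver K f ≡ sumOver K g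
sumOver-cong []      e = refl
sumOver-cong (k ∷ K) e = cong₂ _+_ (e k) (sumOver-cong K e)

sumOver-cong-All : ∀ {K} {f g : A → ℕ} → All (λ k → f k ≡ g k) K → sumOver K f ≡ sumOver K g
sumOver-cong-All []       = refl
sumOver-cong-All (e ∷ es) = cong₂ _+_ e (sumOver-cong-All es)

sumOver-zero : ∀ (K : List A) → sumOver K (const 0) ≡ 0
sumOver-zero []      = refl
sumOver-zero (k ∷ K) = sumOver-zero K

sumOver-map : ∀ {B : Set} (f : B → ℕ) (φ : A → B) O → sumOver O (f ∘ φ) ≡ sumOver (map φ O) f
sumOver-map f φ []      = refl
sumOver-map f φ (o ∷ O) = cong (f (φ o) +_) (sumOver-map f φ O)

sum-sumOver-comm : ∀ K (f : Fin n → Fin n → ℕ) →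
  sum (λ i → sumOver K (f i)) ≡ sumOver K (λ k → sum (λ i → f i k))
sum-sumOver-comm {n} []      f = sum-replicate-zero n
sum-sumOver-comm (k ∷ K) f = begin
  sum (λ i → f i k + sumOver K (f i))                       ≡⟨ ∑-distrib-+ (λ i → f i k) (λ i → sumOver K (f i)) ⟩
  sum (λ i → f i k) + sum (λ i → sumOver K (f i))           ≡⟨ cong (sum (λ i → f i k) +_) (sum-sumOver-comm K f) ⟩
  sum (λ i → f i k) + sumOver K (λ k → sum (λ i → f i k))   ∎
  where open ≡-Reasoning

_without_ : (Fin n → ℕ) → List (Fin n) → Fin n → ℕ
f without []      = f
f without (k ∷ K) = updateAt (f without K) k (const 0)

without-∉ : ∀ (f : Fin n → ℕ) K {i} → i ∉ K → (f without K) i ≡ f i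
without-∉ f []      i∉K = refl
without-∉ f (k ∷ K) i∉K = trans (updateAt-minimal _ k (f without K) (i∉K ∘ here)) (without-∉ f K (i∉K ∘ there))

without-∈ : ∀ (f : Fin n → ℕ) K {i} → i ∈ K → (f without K) i ≡ 0
without-∈ f (k ∷ K) (here refl) = updateAt-updates k (f without K)
without-∈ f (k ∷ K) {i} (there i∈K) with i ≟ k
... | yes refl = updateAt-updates k (f without K)
... | no  i≢k  = trans (updateAt-minimal i k (f without K) i≢k) (without-∈ f K i∈K)

sum-updateAt-0 : ∀ (f : Fin n → ℕ) k → sum f ≡ f k + sum (updateAt f k (const 0))
sum-updateAt-0 f zero    = refl
sum-updateAt-0 f (suc k) =
  trans (cong (f zero +_) (sum-updateAt-0 (f ∘ suc) k)) (x∙yz≈y∙xz (f zero) (f (suc k)) _)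

sum-split : ∀ {K} (f : Fin n → ℕ) → Unique K → sum f ≡ sumOver K f + sum (f without K)
sum-split {K = []}    f _ = refl
sum-split {K = k ∷ K} f K-unique@(_ ∷ K′-unique) = begin
  sum f                                            ≡⟨ sum-split f K′-unique ⟩
  sumOver K f + sum (f without K)                  ≡⟨ cong (sumOver K f +_) (sum-updateAt-0 (f without K) k) ⟩
  sumOver K f + ((f without K) k + sum rest)       ≡⟨ cong (λ x → sumOver K f + (x + sum rest)) (without-∉ f K k∉K) ⟩
  sumOver K f + (f k + sum rest)                   ≡⟨ x∙yz≈y∙xz (sumOver K f) (f k) (sum rest) ⟩
  f k + (sumOver K f + sum rest)                   ≡⟨ +-assoc (f k) (sumOver K f) (sum rest) ⟨
  f k + sumOver K f + sum rest                     ∎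
  where
  open ≡-Reasoning
  rest : Fin _ → ℕ
  rest = f without (k ∷ K)
  k∉K : k ∉ K
  k∉K = Unique[x∷xs]⇒x∉xs K-unique

sumOver≤sum : ∀ {K} (f : Fin n → ℕ) → Unique K → sumOver K f ≤ sum f
sumOver≤sum f K-unique rewrite sum-split f K-unique = m≤m+n _ _

sum-local : ∀ {K} {f g : Fin n → ℕ} → Unique K → (∀ i → i ∉ K → f i ≡ g i) →
  sum f + sumOver K g ≡ sum g + sumOver K f
sum-local {K = K} {f} {g} K-unique f≡g = begin
  sum f + sumOver K g                               ≡⟨ cong (_+ sumOver K g) (sum-split f K-unique) ⟩
  sumOver K f + sum (f without K) + sumOver K g     ≡⟨ cong (λ x → sumOver K f + x + sumOver K g) (sum-cong-≗ outside) ⟩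
  sumOver K f + sum (g without K) + sumOver K g     ≡⟨ xy∙z≈z∙yx (sumOver K f) (sum (g without K)) (sumOver K g) ⟩
  sumOver K g + (sum (g without K) + sumOver K f)   ≡⟨ +-assoc (sumOver K g) (sum (g without K)) (sumOver K f) ⟨
  sumOver K g + sum (g without K) + sumOver K f     ≡⟨ cong (_+ sumOver K f) (sum-split g K-unique) ⟨
  sum g + sumOver K f                               ∎
  where
  open ≡-Reasoning
  outside : ∀ i → (f without K) i ≡ (g without K) i
  outside i with any? (i ≟_) K
  ... | yes i∈K = trans (without-∈ f K i∈K) (sym (without-∈ g K i∈K))
  ... | no  i∉K = trans (without-∉ f K i∉K) (trans (f≡g i i∉K) (sym (without-∉ g K i∉K)))

rowSums : List (Fin n) → (Fin n → Fin n → ℕ) → ℕ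
rowSums K w = sumOver K (sum ∘ w)

blockSum : List (Fin n) → (Fin n → Fin n → ℕ) → ℕ
blockSum K w = sumOver K (λ k → sumOver K (w k))

sum²-local : ∀ {K} {w w′ : Fin n → Fin n → ℕ} → Unique K →
  (∀ i j → w′ i j ≡ w′ j i) → (∀ i j → w i j ≡ w j i) →
  (∀ i j → i ∉ K → j ∉ K → w i j ≡ w′ i j) →
  sum (sum ∘ w) + (rowSums K w′ + rowSums K w′) + blockSum K w
    ≡ sum (sum ∘ w′) + (rowSums K w + rowSums K w) + blockSum K w′
sum²-local {n = n} {K = K} {w} {w′} K-unique w′-sym w-sym agree = begin
  sum (sum ∘ w) + (rowSums K w′ + rowSums K w′) + blockSum K w
    ≡⟨ regroup (sum (sum ∘ w)) (rowSums K w′) (blockSum K w) ⟩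
  (sum (sum ∘ w) + rowSums K w′) + (rowSums K w′ + blockSum K w)
    ≡⟨ cong₂ _+_ (sum-rows w w′ w′-sym) (sumOver-+ K (sum ∘ w′) (λ k → sumOver K (w k))) ⟨
  sum (mixed w w′) + sumOver K (mixed w′ w)
    ≡⟨ sum-local K-unique (λ i i∉K → sum-local K-unique (λ j j∉K → agree i j i∉K j∉K)) ⟩
  sum (mixed w′ w) + sumOver K (mixed w w′)
    ≡⟨ cong₂ _+_ (sum-rows w′ w w-sym) (sumOver-+ K (sum ∘ w) (λ k → sumOver K (w′ k))) ⟩
  (sum (sum ∘ w′) + rowSums K w) + (rowSums K w + blockSum K w′)
    ≡⟨ regroup (sum (sum ∘ w′)) (rowSums K w) (blockSum K w′) ⟨
  sum (sum ∘ w′) + (rowSums K w + rowSums K w) + blockSum K w′ ∎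
  where
  open ≡-Reasoning
  mixed : (Fin n → Fin n → ℕ) → (Fin n → Fin n → ℕ) → Fin n → ℕ
  mixed v v′ i = sum (v i) + sumOver K (v′ i)
  sum-rows : ∀ v v′ → (∀ i j → v′ i j ≡ v′ j i) → sum (mixed v v′) ≡ sum (sum ∘ v) + rowSums K v′
  sum-rows v v′ v′-sym = begin
    sum (mixed v v′)                                      ≡⟨ ∑-distrib-+ (sum ∘ v) (λ i → sumOver K (v′ i)) ⟩
    sum (sum ∘ v) + sum (λ i → sumOver K (v′ i))          ≡⟨ cong (sum (sum ∘ v) +_) (sum-sumOver-comm K v′) ⟩
    sum (sum ∘ v) + sumOver K (λ k → sum (λ i → v′ i k))
      ≡⟨ cong (sum (sum ∘ v) +_) (sumOver-cong K (λ k → sum-cong-≗ (λ i → v′-sym i k))) ⟩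
    sum (sum ∘ v) + rowSums K v′                          ∎
  regroup : ∀ t r b → t + (r + r) + b ≡ (t + r) + (r + b)
  regroup = solve 3 (λ t r b → t :+ (r :+ r) :+ b := (t :+ r) :+ (r :+ b)) refl

halve : ∀ {a b c d} e → a + a + (b + b) + e ≡ c + c + (d + d) + e → a + b ≡ c + d
halve {a} {b} {c} {d} e eq = *-cancelʳ-≡ (a + b) (c + d) 2 (begin
  (a + b) * 2            ≡⟨ double a b ⟩
  a + a + (b + b)        ≡⟨ +-cancelʳ-≡ e _ _ eq ⟩
  c + c + (d + d)        ≡⟨ double c d ⟨
  (c + d) * 2            ∎)
  where
  open ≡-Reasoning
  double : ∀ x y → (x + y) * 2 ≡ x + x + (y + y)
  double = solve 2 (λ x y → (x :+ y) :* con 2 := x :+ x :+ (y :+ y)) refl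

-- Transpositions and injections

transpose-left : ∀ (i j : Fin n) → transpose i j i ≡ j
transpose-left i j rewrite dec-true (i ≟ i) refl = refl

transpose-right : ∀ (i j : Fin n) → transpose i j j ≡ i
transpose-right i j with j ≟ i
... | yes j≡i = j≡i
... | no  _   rewrite dec-true (j ≟ j) refl = refl

transpose-fixes : ∀ {i j k : Fin n} → k ≢ i → k ≢ j → transpose i j k ≡ k
transpose-fixes {i = i} {j} {k} k≢i k≢j rewrite dec-false (k ≟ i) k≢i | dec-false (k ≟ j) k≢j = refl

transpose-injective : ∀ (i j : Fin n) → Injective _≡_ _≡_ (transpose i j)
transpose-injective i j {a} {b} e = begin
  a                                ≡⟨ transpose-inverse j i ⟨
  transpose j i (transpose i j a)  ≡⟨ cong (transpose j i) e ⟩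
  transpose j i (transpose i j b)  ≡⟨ transpose-inverse j i ⟩
  b                                ∎
  where open ≡-Reasoning

extend-injection : (ps : List (Fin n × Fin n)) → Unique (map proj₁ ps) → Unique (map proj₂ ps) →
  ∃ λ φ → Injective _≡_ _≡_ φ × All (λ (i , j) → φ i ≡ j) ps
extend-injection []             _                  _                  = id , id , []
extend-injection ((i , j) ∷ ps) (i∉ ∷ dom-unique) (j∉ ∷ cod-unique)
  with extend-injection ps dom-unique cod-unique
... | φ , φ-injective , φ-maps =
  ψ , φ-injective ∘ transpose-injective (φ i) j , transpose-left (φ i) j ∷ keeps ps i∉ j∉ φ-maps
  where
  ψ : Fin _ → Fin _
  ψ = transpose (φ i) j ∘ φ
  keeps : ∀ qs → All (i ≢_) (map proj₁ qs) → All (j ≢_) (map proj₂ qs) →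
    All (λ (i , j) → φ i ≡ j) qs → All (λ (i , j) → ψ i ≡ j) qs
  keeps []               _             _             _           = []
  keeps ((i′ , j′) ∷ qs) (i≢i′ ∷ i∉qs) (j≢j′ ∷ j∉qs) (φi′≡j′ ∷ es) =
    trans (cong (transpose (φ i) j) φi′≡j′)
          (transpose-fixes (λ j′≡φi → i≢i′ (φ-injective (trans (sym j′≡φi) (sym φi′≡j′))))
                           (j≢j′ ∘ sym))
    ∷ keeps qs i∉qs j∉qs es

fresh-vertex : (xs : List (Fin n)) → length xs < n → ∃ λ z → z ∉ xs
fresh-vertex {n} xs |xs|<n with all? (λ z → any? (z ≟_) xs)
... | no  ¬all∈ = ¬∀⟶∃¬ n (_∈ xs) (λ z → any? (z ≟_) xs) ¬all∈
... | yes all∈ with pigeonhole |xs|<n (λ z → index (all∈ z))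
...   | i , j , i<j , same-index = contradiction i≡j (<⇒≢ i<j)
  where
  i≡j : i ≡ j
  i≡j = trans (lookup-index (all∈ i)) (trans (cong (lookup xs) same-index) (sym (lookup-index (all∈ j))))

NotIn4⇒∉ : ∀ {z a b c d : Fin n} → NotIn4 z a b c d → z ∉ (a ∷ b ∷ c ∷ d ∷ [])
NotIn4⇒∉ (z≢a , _ , _ , _) (here z≡a)                         = z≢a z≡a
NotIn4⇒∉ (_ , z≢b , _ , _) (there (here z≡b))                 = z≢b z≡b
NotIn4⇒∉ (_ , _ , z≢c , _) (there (there (here z≡c)))         = z≢c z≡c
NotIn4⇒∉ (_ , _ , _ , z≢d) (there (there (there (here z≡d)))) = z≢d z≡d

avoids-inner : ∀ {z v₁ v₂ v₃ v₄ : Fin n} → z ∉ (v₁ ∷ v₂ ∷ v₃ ∷ v₄ ∷ []) → z ≢ v₂ × z ≢ v₃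
avoids-inner z∉ = z∉ ∘ there ∘ here , z∉ ∘ there ∘ there ∘ here

NotIn4-reverse : ∀ {z v₁ v₂ v₃ v₄ : Fin n} → NotIn4 z v₁ v₂ v₃ v₄ → NotIn4 z v₄ v₃ v₂ v₁
NotIn4-reverse (z≢v₁ , z≢v₂ , z≢v₃ , z≢v₄) = z≢v₄ , z≢v₃ , z≢v₂ , z≢v₁

Distinct4-reverse : ∀ {v₁ v₂ v₃ v₄ : Fin n} → Distinct4 v₁ v₂ v₃ v₄ → Distinct4 v₄ v₃ v₂ v₁
Distinct4-reverse (v₁≢v₂ , v₁≢v₃ , v₁≢v₄ , v₂≢v₃ , v₂≢v₄ , v₃≢v₄) =
  v₃≢v₄ ∘ sym , v₂≢v₄ ∘ sym , v₁≢v₄ ∘ sym , v₂≢v₃ ∘ sym , v₁≢v₃ ∘ sym , v₁≢v₂ ∘ sym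

∉-∷⁺ : ∀ {x y : A} {ys} → x ≢ y → x ∉ ys → x ∉ y ∷ ys
∉-∷⁺ x≢y _   (here x≡y)  = x≢y x≡y
∉-∷⁺ _   x∉ (there x∈) = x∉ x∈

unique-++ : ∀ {C zs xs : List A} → Unique zs → Unique xs → All (_∉ C) zs → All (_∈ C) xs →
  Unique (zs ++ xs)
unique-++ zs-unique xs-unique zs∉C xs∈C =
  ++⁺ zs-unique xs-unique (λ (v∈zs , v∈xs) → All.lookup zs∉C v∈zs (All.lookup xs∈C v∈xs))

unique-++-quadruple : ∀ {zs : List (Fin n)} {a b c d} → Unique zs → All (_∉ (a ∷ b ∷ c ∷ d ∷ [])) zs →
  Distinct4 a b c d → Unique (zs ++ a ∷ b ∷ c ∷ d ∷ [])
unique-++-quadruple zs-unique zs-outside (a≢b , a≢c , a≢d , b≢c , b≢d , c≢d) =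
  unique-++ zs-unique ((a≢b ∷ a≢c ∷ a≢d ∷ []) ∷ (b≢c ∷ b≢d ∷ []) ∷ (c≢d ∷ []) ∷ [] ∷ [])
    zs-outside (All.tabulate id)

-- The cycle a b c d, listed as it is placed on a path v₁ v₂ v₃ v₄.
unique-++-cycle : ∀ {zs : List (Fin n)} {a b c d} → Unique zs → All (_∉ (a ∷ b ∷ c ∷ d ∷ [])) zs →
  Distinct4 a b c d → Unique (zs ++ a ∷ b ∷ d ∷ c ∷ [])
unique-++-cycle zs-unique zs-outside (a≢b , a≢c , a≢d , b≢c , b≢d , c≢d) =
  unique-++ zs-unique ((a≢b ∷ a≢d ∷ a≢c ∷ []) ∷ (b≢d ∷ b≢c ∷ []) ∷ (c≢d ∘ sym ∷ []) ∷ [] ∷ [])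
    zs-outside
    (here refl ∷ there (here refl) ∷ there (there (there (here refl))) ∷ there (there (here refl)) ∷ [])

-- Colourings of the complete graph

colour : Coloring n → Fin n → Fin n → ℕ
colour χ a b = toℕ (χ a b)

colour-sym : ∀ {χ : Coloring n} → SymColoring χ → ∀ a b → colour χ a b ≡ colour χ b a
colour-sym χ-sym a b = cong toℕ (χ-sym a b)

AlternatingSums : Coloring n → Fin n → Fin n → Fin n → Fin n → Set
AlternatingSums χ a b c d = ¬ colour χ a b + colour χ c d ≡₃ colour χ b c + colour χ d a

record BicolouredCherry (χ : Coloring n) (C : List (Fin n)) : Set where
  constructor cherry
  field
    centre end₁ end₂ : Fin n
    distinct   : Unique (end₁ ∷ end₂ ∷ centre ∷ [])
    outside    : All (_∉ C) (end₁ ∷ end₂ ∷ centre ∷ [])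
    bicoloured : χ centre end₁ ≢ χ centre end₂

module _ {χ : Coloring n} (χ-sym : SymColoring χ) where

  -- The matching differences of the cycles a b c d, y a b c and y c d a add up to 0.
  alternating-through : ∀ {a b c d} → AlternatingSums χ a b c d → ∀ y →
    AlternatingSums χ y a b c ⊎ AlternatingSums χ y c d a
  alternating-through {a} {b} {c} {d} abcd y with colour χ y a + colour χ b c ≟₃ colour χ a b + colour χ c y
  ... | no  yabc  = inj₁ yabc
  ... | yes yabc≡ = inj₂ λ ycda≡ → abcd (≡₃-sym (+-cancelʳ-≡₃ (k y a + k y c) (begin
    k b c + k d a + (k y a + k y c)     ≡⟨ regroup (k b c) (k d a) (k y a) (k y c) ⟩
    (k y a + k b c) + (k y c + k d a)   ≈⟨ +-cong-≡₃ yabc≡ ycda≡ ⟩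
    (k a b + k c y) + (k c d + k a y)   ≡⟨ cong₂ (λ u v → k a b + u + (k c d + v))
                                                 (colour-sym χ-sym c y) (colour-sym χ-sym a y) ⟩
    (k a b + k y c) + (k c d + k y a)   ≡⟨ regroup′ (k a b) (k c d) (k y a) (k y c) ⟩
    k a b + k c d + (k y a + k y c)     ∎)))
    where
    open ≡₃-Reasoning
    k : Fin n → Fin n → ℕ
    k = colour χ
    regroup : ∀ bc da ya yc → bc + da + (ya + yc) ≡ (ya + bc) + (yc + da)
    regroup = solve 4 (λ bc da ya yc → bc :+ da :+ (ya :+ yc) := (ya :+ bc) :+ (yc :+ da)) refl
    regroup′ : ∀ ab cd ya yc → (ab + yc) + (cd + ya) ≡ ab + cd + (ya + yc)
    regroup′ = solve 4 (λ ab cd ya yc → (ab :+ yc) :+ (cd :+ ya) := ab :+ cd :+ (ya :+ yc)) refl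

  cherry-at : ∀ {C} c e₁ e₂ → e₁ ≢ c → e₂ ≢ c → χ c e₁ ≢ χ c e₂ →
    All (_∉ C) (e₁ ∷ e₂ ∷ c ∷ []) → BicolouredCherry χ C
  cherry-at c e₁ e₂ e₁≢c e₂≢c bicoloured outside =
    cherry c e₁ e₂ ((e₁≢e₂ ∷ e₁≢c ∷ []) ∷ (e₂≢c ∷ []) ∷ [] ∷ []) outside bicoloured
    where
    e₁≢e₂ : e₁ ≢ e₂
    e₁≢e₂ refl = bicoloured refl

  -- If the two edges are disjoint, either x sees the colours χ x y ≠ χ x z,
  -- or z sees the colours χ z x = χ x y ≠ χ z t.
  cherry-from-edges : ∀ {C x y z t} → x ≢ y → z ≢ t → x ∉ C → y ∉ C → z ∉ C → t ∉ C →
    χ x y ≢ χ z t → BicolouredCherry χ C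
  cherry-from-edges {x = x} {y} {z} {t} x≢y z≢t x∉ y∉ z∉ t∉ xy≢zt
    with x ≟ z | x ≟ t | y ≟ z | y ≟ t
  ... | yes refl | _        | _        | _        =
    cherry-at x y t (x≢y ∘ sym) (z≢t ∘ sym) xy≢zt (y∉ ∷ t∉ ∷ x∉ ∷ [])
  ... | no _     | yes refl | _        | _        =
    cherry-at x y z (x≢y ∘ sym) z≢t (λ e → xy≢zt (trans e (χ-sym x z))) (y∉ ∷ z∉ ∷ x∉ ∷ [])
  ... | no _     | no _     | yes refl | _        =
    cherry-at y x t x≢y (z≢t ∘ sym) (λ e → xy≢zt (trans (χ-sym x y) e)) (x∉ ∷ t∉ ∷ y∉ ∷ [])
  ... | no _     | no _     | no _     | yes refl =
    cherry-at y x z x≢y z≢t (λ e → xy≢zt (trans (χ-sym x y) (trans e (χ-sym y z)))) (x∉ ∷ z∉ ∷ y∉ ∷ [])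
  ... | no x≢z   | no _     | no _     | no _     with χ x y ≟ χ x z
  ...   | no  xy≢xz = cherry-at x y z (x≢y ∘ sym) (x≢z ∘ sym) xy≢xz (y∉ ∷ z∉ ∷ x∉ ∷ [])
  ...   | yes xy≡xz =
    cherry-at z x t x≢z (z≢t ∘ sym) (λ e → xy≢zt (trans xy≡xz (trans (χ-sym x z) e))) (x∉ ∷ t∉ ∷ z∉ ∷ [])

  NotMonoOutside⇒cherry : ∀ {a b c d} → NotMonoOutside χ a b c d → BicolouredCherry χ (a ∷ b ∷ c ∷ d ∷ [])
  NotMonoOutside⇒cherry (x , y , z , t , x≢y , z≢t , x-out , y-out , z-out , t-out , xy≢zt) =
    cherry-from-edges x≢y z≢t (NotIn4⇒∉ x-out) (NotIn4⇒∉ y-out) (NotIn4⇒∉ z-out) (NotIn4⇒∉ t-out) xy≢zt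

  bicoloured⇒single-sums-differ : ∀ {y s t} → χ y s ≢ χ y t →
    ¬ sumOver (y ∷ []) (colour χ s) ≡₃ sumOver (y ∷ []) (colour χ t)
  bicoloured⇒single-sums-differ {y} {s} {t} bicoloured e =
    bicoloured (trans (χ-sym y s) (trans (toℕ-≡₃-injective without-zeros) (χ-sym t y)))
    where
    without-zeros : colour χ s y ≡₃ colour χ t y
    without-zeros = subst₂ _≡₃_ (+-identityʳ _) (+-identityʳ _) e

-- If all three pairs had equal sums, the first two minus the third would give
-- σ y + σ y ≡₃ τ y + τ y.
pair-with-unequal-sums : ∀ (σ τ : A → ℕ) {y p q} → ¬ σ y ≡₃ τ y →
  ¬ sumOver (y ∷ p ∷ []) σ ≡₃ sumOver (y ∷ p ∷ []) τ
  ⊎ ¬ sumOver (y ∷ q ∷ []) σ ≡₃ sumOver (y ∷ q ∷ []) τ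
  ⊎ ¬ sumOver (p ∷ q ∷ []) σ ≡₃ sumOver (p ∷ q ∷ []) τ
pair-with-unequal-sums σ τ {y} {p} {q} σy≢τy with sumOver (y ∷ p ∷ []) σ ≟₃ sumOver (y ∷ p ∷ []) τ
... | no  yp  = inj₁ yp
... | yes yp≡ with sumOver (y ∷ q ∷ []) σ ≟₃ sumOver (y ∷ q ∷ []) τ
...   | no  yq  = inj₂ (inj₁ yq)
...   | yes yq≡ = inj₂ (inj₂ λ pq≡ →
  σy≢τy (m+m≡₃n+n⇒m≡₃n (+-cancelʳ-≡₃ (σ p + σ q + (τ p + τ q)) (begin
  σ y + σ y + (σ p + σ q + (τ p + τ q))
    ≡⟨ regroup (σ y) (σ p) (σ q) (τ p) (τ q) ⟩
  sumOver (y ∷ p ∷ []) σ + sumOver (y ∷ q ∷ []) σ + sumOver (p ∷ q ∷ []) τ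
    ≈⟨ +-cong-≡₃ (+-cong-≡₃ yp≡ yq≡) (≡₃-sym pq≡) ⟩
  sumOver (y ∷ p ∷ []) τ + sumOver (y ∷ q ∷ []) τ + sumOver (p ∷ q ∷ []) σ
    ≡⟨ regroup (τ y) (τ p) (τ q) (σ p) (σ q) ⟨
  τ y + τ y + (τ p + τ q + (σ p + σ q))
    ≡⟨ cong (τ y + τ y +_) (+-comm (τ p + τ q) (σ p + σ q)) ⟩
  τ y + τ y + (σ p + σ q + (τ p + τ q))  ∎))))
  where
  open ≡₃-Reasoning
  regroup : ∀ y p q p′ q′ → y + y + (p + q + (p′ + q′)) ≡ (y + (p + 0)) + (y + (q + 0)) + (p′ + (q′ + 0))
  regroup = solve 5 (λ y p q p′ q′ → y :+ y :+ (p :+ q :+ (p′ :+ q′))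
                                    := (y :+ (p :+ con 0)) :+ (y :+ (q :+ con 0)) :+ (p′ :+ (q′ :+ con 0))) refl

-- Neighbourhoods, switching structures and leaf swaps

module _ {n} (G : Graph n) where

  adj-sym : ∀ {i j} → Adj G i j → Adj G j i
  adj-sym {i} {j} i~j = trans (Graph.sym G j i) i~j

  adj⇒≢ : ∀ {i j} → Adj G i j → i ≢ j
  adj⇒≢ {i} i~j refl with trans (sym i~j) (irrefl G i)
  ... | ()

  record Neighbourhood (k : Fin n) (N : List (Fin n)) : Set where
    field
      distinct : Unique N
      adjacent : All (Adj G k) N
      complete : ∀ {j} → Adj G k j → j ∈ N

  sumOver-bits : ∀ {k N} → All (Adj G k) N → sumOver N (λ j → bit (adj G k j)) ≡ length N
  sumOver-bits []                = refl
  sumOver-bits (k~j ∷ k~N) rewrite k~j = cong suc (sumOver-bits k~N)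

  neighbourhood-by-degree : ∀ {k N} → Unique N → All (Adj G k) N → degree G k ≡ length N → Neighbourhood k N
  neighbourhood-by-degree {k} {N} N-unique k~N deg = record
    { distinct = N-unique ; adjacent = k~N ; complete = complete }
    where
    complete : ∀ {j} → Adj G k j → j ∈ N
    complete {j} k~j with any? (j ≟_) N
    ... | yes j∈N = j∈N
    ... | no  j∉N = contradiction too-many (n≮n (length N))
      where
      bits : Fin n → ℕ
      bits i = bit (adj G k i)
      too-many : suc (length N) ≤ length N
      too-many = begin
        suc (length N)        ≡⟨ sumOver-bits (k~j ∷ k~N) ⟨
        sumOver (j ∷ N) bits  ≤⟨ sumOver≤sum bits (¬Any⇒All¬ N j∉N ∷ N-unique) ⟩
        sum bits              ≡⟨ Σv≡sum bits ⟨
        degree G k            ≡⟨ deg ⟩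
        length N              ∎
        where open ≤-Reasoning

  leaf-neighbourhood : ∀ {p l} → Leaf G l → Adj G p l → Neighbourhood l (p ∷ [])
  leaf-neighbourhood leaf p~l = neighbourhood-by-degree ([] ∷ []) (adj-sym p~l ∷ []) leaf

  leaf-parent : ∀ {p l j} → Leaf G l → Adj G p l → Adj G l j → j ≡ p
  leaf-parent leaf p~l l~j with Neighbourhood.complete (leaf-neighbourhood leaf p~l) l~j
  ... | here j≡p = j≡p

  leafSide-distinct : ∀ {u x l v} → LeafSide G u x l → Adj G u v → x ≢ v → u ≢ l × v ≢ l
  leafSide-distinct (u~l , inj₁ (refl , _)) _ l≢v = adj⇒≢ u~l , l≢v ∘ sym
  leafSide-distinct {u} {x} {l} {v} (u~x , inj₂ (leaf , x~l)) u~v x≢v = u≢l , v≢l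
    where
    u≢l : u ≢ l
    u≢l refl = x≢v (sym (leaf-parent leaf x~l u~v))
    v≢l : v ≢ l
    v≢l refl = adj⇒≢ u~x (leaf-parent leaf x~l (adj-sym u~v))

  inner-neighbours : ∀ {v₁ v₂ v₃ v₄} → SwitchingStructure G v₁ v₂ v₃ v₄ →
    ∀ {j} → Adj G v₂ j ⊎ Adj G v₃ j → j ∈ (v₁ ∷ v₂ ∷ v₃ ∷ v₄ ∷ [])
  inner-neighbours ((_ , v₁≢v₃ , _ , _ , _ , _) , inj₁ (v₁~v₂ , v₂~v₃ , _ , deg₂ , _)) (inj₁ v₂~j)
    with Neighbourhood.complete
           (neighbourhood-by-degree ((v₁≢v₃ ∷ []) ∷ [] ∷ []) (adj-sym v₁~v₂ ∷ v₂~v₃ ∷ []) deg₂) v₂~j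
  ... | here refl         = here refl
  ... | there (here refl) = there (there (here refl))
  inner-neighbours ((_ , _ , _ , _ , v₂≢v₄ , _) , inj₁ (_ , v₂~v₃ , v₃~v₄ , _ , deg₃)) (inj₂ v₃~j)
    with Neighbourhood.complete
           (neighbourhood-by-degree ((v₂≢v₄ ∷ []) ∷ [] ∷ []) (adj-sym v₂~v₃ ∷ v₃~v₄ ∷ []) deg₃) v₃~j
  ... | here refl         = there (here refl)
  ... | there (here refl) = there (there (there (here refl)))
  inner-neighbours (_ , inj₂ ((leaf₂ , v₁~v₂) , _)) (inj₁ v₂~j) with leaf-parent leaf₂ v₁~v₂ v₂~j
  ... | refl = here refl
  inner-neighbours (_ , inj₂ (_ , (leaf₃ , v₄~v₃))) (inj₂ v₃~j) with leaf-parent leaf₃ v₄~v₃ v₃~j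
  ... | refl = there (there (there (here refl)))

  outside-neighbour-avoids-inner : ∀ {v₁ v₂ v₃ v₄} → SwitchingStructure G v₁ v₂ v₃ v₄ →
    ∀ {u j} → u ∉ (v₁ ∷ v₂ ∷ v₃ ∷ v₄ ∷ []) → Adj G u j → j ≢ v₂ × j ≢ v₃
  outside-neighbour-avoids-inner S u∉ u~j =
    (λ { refl → u∉ (inner-neighbours S (inj₁ (adj-sym u~j))) }) ,
    (λ { refl → u∉ (inner-neighbours S (inj₂ (adj-sym u~j))) })

  switching-reverse : ∀ {v₁ v₂ v₃ v₄} → SwitchingStructure G v₁ v₂ v₃ v₄ →
    SwitchingStructure G v₄ v₃ v₂ v₁
  switching-reverse (distinct , inj₁ (v₁~v₂ , v₂~v₃ , v₃~v₄ , deg₂ , deg₃)) =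
    Distinct4-reverse distinct , inj₁ (adj-sym v₃~v₄ , adj-sym v₂~v₃ , adj-sym v₁~v₂ , deg₃ , deg₂)
  switching-reverse (distinct , inj₂ (v₁v₂-leaf , v₄v₃-leaf)) =
    Distinct4-reverse distinct , inj₂ (v₄v₃-leaf , v₁v₂-leaf)

  -- A generalized switching structure (l, u) in which u has the neighbours via ∷ O.
  record LeafSwap (u l : Fin n) (O : List (Fin n)) : Set where
    field
      via      : Fin n
      u≢l      : u ≢ l
      degree-u : degree G u ≡ length (via ∷ O)
      adjacent : All (Adj G u) O
      unique   : Unique (via ∷ O)
      leafSide : LeafSide G u via l

  leafSwap₂ : ∀ {u x l v} → degree G u ≡ 2 → x ≢ v → Adj G u v → LeafSide G u x l → LeafSwap u l (v ∷ [])
  leafSwap₂ {x = x} deg x≢v u~v leafSide = record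
    { via = x ; u≢l = proj₁ (leafSide-distinct leafSide u~v x≢v) ; degree-u = deg ; adjacent = u~v ∷ []
    ; unique = (x≢v ∷ []) ∷ [] ∷ [] ; leafSide = leafSide }

  leafSwap₃ : ∀ {u x l v w} → degree G u ≡ 3 → Adj G u v → Adj G u w → v ≢ w → x ≢ v → x ≢ w →
    LeafSide G u x l → LeafSwap u l (v ∷ w ∷ [])
  leafSwap₃ {x = x} deg u~v u~w v≢w x≢v x≢w leafSide = record
    { via = x ; u≢l = proj₁ (leafSide-distinct leafSide u~v x≢v) ; degree-u = deg ; adjacent = u~v ∷ u~w ∷ []
    ; unique = (x≢v ∷ x≢w ∷ []) ∷ (v≢w ∷ []) ∷ [] ∷ [] ; leafSide = leafSide }

-- Colour sums of copies and transpositions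

colourOf : Coloring n → (Fin n → Fin n) → Fin n → Fin n → ℕ
colourOf χ φ i j = colour χ (φ i) (φ j)

sumOver-transposed : ∀ (χ : Coloring n) φ a {p q b O} → transpose p q a ≡ b → All (λ o → transpose p q o ≡ o) O →
  sumOver O (colourOf χ (φ ∘ transpose p q) a) ≡ sumOver O (colourOf χ φ b)
sumOver-transposed χ φ a τa≡b fixed = sumOver-cong-All (All.map (cong₂ (colourOf χ φ) τa≡b) fixed)

module _ {n} (G : Graph n) (χ : Coloring n) where

  weight : (Fin n → Fin n) → Fin n → Fin n → ℕ
  weight φ i j = if adj G i j then colourOf χ φ i j else 0

  colourDegree : (Fin n → Fin n) → Fin n → ℕ
  colourDegree φ k = sum (weight φ k)

  -- Transposing p and q in a copy φ replaces edges of colour sum old φ by edges of colour sum new φ.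
  SwapTrades : Fin n → Fin n → (new old : (Fin n → Fin n) → ℕ) → Set
  SwapTrades p q new old = ∀ φ → copyColorSum G χ φ + new φ ≡ copyColorSum G χ (φ ∘ transpose p q) + old φ

  colourDegree-neighbourhood : ∀ φ {k N} → Neighbourhood G k N → colourDegree φ k ≡ sumOver N (colourOf χ φ k)
  colourDegree-neighbourhood φ {k} {N} nbhd = begin
    sum (weight φ k)                                 ≡⟨ +-identityʳ (sum (weight φ k)) ⟨
    sum (weight φ k) + 0                             ≡⟨ cong (sum (weight φ k) +_) (sumOver-zero N) ⟨
    sum (weight φ k) + sumOver N (const 0)           ≡⟨ sum-local {f = weight φ k} {g = const 0} distinct off-N ⟩
    sum {n} (const 0) + sumOver N (weight φ k)       ≡⟨ cong (_+ sumOver N (weight φ k)) (sum-replicate-zero n) ⟩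
    sumOver N (weight φ k)                           ≡⟨ sumOver-cong-All (All.map on-N adjacent) ⟩
    sumOver N (colourOf χ φ k)                       ∎
    where
    open ≡-Reasoning
    open Neighbourhood nbhd
    off-N : ∀ j → j ∉ N → weight φ k j ≡ 0
    off-N j j∉N rewrite ¬-not (j∉N ∘ complete) = refl
    on-N : ∀ {j} → Adj G k j → weight φ k j ≡ colourOf χ φ k j
    on-N k~j rewrite k~j = refl

  weight-diagonal : ∀ φ k → weight φ k k ≡ 0
  weight-diagonal φ k rewrite irrefl G k = refl

  blockSum-transposed : ∀ φ p q →
    blockSum (p ∷ q ∷ []) (weight (φ ∘ transpose p q)) ≡ blockSum (p ∷ q ∷ []) (weight φ)
  blockSum-transposed φ p q = begin
    blockSum K (weight ψ)              ≡⟨ blockSum-pair ψ ⟩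
    weight ψ p q + weight ψ q p        ≡⟨ cong₂ _+_ (swapped (transpose-left p q) (transpose-right p q))
                                                     (swapped (transpose-right p q) (transpose-left p q)) ⟩
    weight φ q p + weight φ p q        ≡⟨ +-comm (weight φ q p) (weight φ p q) ⟩
    weight φ p q + weight φ q p        ≡⟨ blockSum-pair φ ⟨
    blockSum K (weight φ)              ∎
    where
    open ≡-Reasoning
    ψ : Fin n → Fin n
    ψ = φ ∘ transpose p q
    K : List (Fin n)
    K = p ∷ q ∷ []
    swapped : ∀ {a b} → transpose p q a ≡ b → transpose p q b ≡ a → weight ψ a b ≡ weight φ b a
    swapped {a} {b} τa≡b τb≡a =
      trans (cong₂ (λ x y → if adj G a b then colour χ (φ x) (φ y) else 0) τa≡b τb≡a)
            (cong (λ c → if c then colourOf χ φ b a else 0) (Graph.sym G a b))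
    blockSum-pair : ∀ φ′ → blockSum K (weight φ′) ≡ weight φ′ p q + weight φ′ q p
    blockSum-pair φ′ = begin
      w p p + (w p q + 0) + (w q p + (w q q + 0) + 0)
        ≡⟨ cong₂ (λ x y → x + (w p q + 0) + (w q p + (y + 0) + 0)) (weight-diagonal φ′ p) (weight-diagonal φ′ q) ⟩
      0 + (w p q + 0) + (w q p + (0 + 0) + 0)
        ≡⟨ cong₂ _+_ (+-identityʳ (w p q)) (trans (+-identityʳ _) (+-identityʳ _)) ⟩
      w p q + w q p                                    ∎
      where
      w : Fin n → Fin n → ℕ
      w = weight φ′

  zeroSumCopy-from-swaps : ∀ {p q p′ q′} {new old new′ old′ : (Fin n → Fin n) → ℕ} →
    SwapTrades p q new old → SwapTrades p′ q′ new′ old′ →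
    ∀ {φ} → Injective _≡_ _≡_ φ →
    new′ (φ ∘ transpose p q) ≡ new′ φ → old′ (φ ∘ transpose p q) ≡ old′ φ →
    ¬ new φ ≡₃ old φ → ¬ new′ φ ≡₃ old′ φ → HasZeroSumCopy G χ
  zeroSumCopy-from-swaps {p} {q} {p′} {q′} {new′ = new′} {old′} trades trades′ {φ} φ-injective new′-kept old′-kept
    new≢old new′≢old′ with zero-residue-among-four (trades φ) (trades′ φ) after-first new≢old new′≢old′
    where
    after-first : copyColorSum G χ (φ ∘ transpose p q) + new′ φ
                ≡ copyColorSum G χ (φ ∘ transpose p q ∘ transpose p′ q′) + old′ φ
    after-first = subst₂ (λ a b → copyColorSum G χ (φ ∘ transpose p q) + a
                                ≡ copyColorSum G χ (φ ∘ transpose p q ∘ transpose p′ q′) + b)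
                         new′-kept old′-kept (trades′ (φ ∘ transpose p q))
  ... | inj₁ z               = φ , φ-injective , residues z
  ... | inj₂ (inj₁ z)        = φ ∘ transpose p q , transpose-injective p q ∘ φ-injective , residues z
  ... | inj₂ (inj₂ (inj₁ z)) = φ ∘ transpose p′ q′ , transpose-injective p′ q′ ∘ φ-injective , residues z
  ... | inj₂ (inj₂ (inj₂ z)) = φ ∘ transpose p q ∘ transpose p′ q′ ,
                               transpose-injective p′ q′ ∘ transpose-injective p q ∘ φ-injective , residues z

  module _ (χ-sym : SymColoring χ) where

    weight-sym : ∀ φ i j → weight φ i j ≡ weight φ j i
    weight-sym φ i j rewrite Graph.sym G i j with adj G j i
    ... | true  = colour-sym χ-sym (φ i) (φ j)
    ... | false = refl

    copyColorSum-double : ∀ φ → copyColorSum G χ φ + copyColorSum G χ φ ≡ sum (colourDegree φ)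
    copyColorSum-double φ = begin
      H + H                                                       ≡⟨ cong₂ _+_ H≡ H≡ ⟩
      sum (sum ∘ half) + sum (sum ∘ half)                         ≡⟨ cong (sum (sum ∘ half) +_) (∑-comm half) ⟩
      sum (sum ∘ half) + sum (λ i → sum (λ j → half j i))         ≡⟨ ∑-distrib-+ (sum ∘ half) _ ⟨
      sum (λ i → sum (half i) + sum (λ j → half j i))             ≡⟨ sum-cong-≗ (λ i → ∑-distrib-+ (half i) _) ⟨
      sum (λ i → sum (λ j → half i j + half j i))                 ≡⟨ sum-cong-≗ (λ i → sum-cong-≗ (halves i)) ⟩
      sum (colourDegree φ)                                        ∎
      where
      open ≡-Reasoning
      half : Fin n → Fin n → ℕ
      half i j = if adj G i j ∧ (toℕ i <ᵇ toℕ j) then toℕ (χ (φ i) (φ j)) else 0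
      H : ℕ
      H = copyColorSum G χ φ
      H≡ : H ≡ sum (sum ∘ half)
      H≡ = trans (Σv≡sum (λ i → Σv (half i))) (sum-cong-≗ (λ i → Σv≡sum (half i)))
      halves : ∀ i j → half i j + half j i ≡ weight φ i j
      halves i j rewrite Graph.sym G j i with adj G i j in i~j
      ... | false = refl
      ... | true with toℕ i <ᵇ toℕ j | <ᵇ-reflects-< (toℕ i) (toℕ j)
                   | toℕ j <ᵇ toℕ i | <ᵇ-reflects-< (toℕ j) (toℕ i)
      ...   | true  | ofʸ i<j | true  | ofʸ j<i = contradiction j<i (<-asym i<j)
      ...   | true  | _       | false | _       = +-identityʳ _
      ...   | false | _       | true  | _       = colour-sym χ-sym (φ j) (φ i)
      ...   | false | ofⁿ i≮j | false | ofⁿ j≮i =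
        contradiction (toℕ-injective (≤-antisym (≮⇒≥ j≮i) (≮⇒≥ i≮j))) (adj⇒≢ G i~j)

    -- Only the rows and columns of p and q in the ordered-pair weight matrix change.
    colourSum-transpose : ∀ φ {p q} → p ≢ q →
      copyColorSum G χ φ + (colourDegree (φ ∘ transpose p q) p + colourDegree (φ ∘ transpose p q) q)
        ≡ copyColorSum G χ (φ ∘ transpose p q) + (colourDegree φ p + colourDegree φ q)
    colourSum-transpose φ {p} {q} p≢q =
      halve {S φ} {D ψ} {S ψ} {D φ} (blockSum K (weight φ)) (begin
        S φ + S φ + (D ψ + D ψ) + blockSum K (weight φ)
          ≡⟨ cong₂ (λ t d → t + (d + d) + blockSum K (weight φ)) (copyColorSum-double φ) (D-rowSums ψ) ⟩
        sum (colourDegree φ) + (rowSums K (weight ψ) + rowSums K (weight ψ)) + blockSum K (weight φ)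
          ≡⟨ sum²-local K-unique (weight-sym ψ) (weight-sym φ) agree ⟩
        sum (colourDegree ψ) + (rowSums K (weight φ) + rowSums K (weight φ)) + blockSum K (weight ψ)
          ≡⟨ cong (sum (colourDegree ψ) + (rowSums K (weight φ) + rowSums K (weight φ)) +_)
                  (blockSum-transposed φ p q) ⟩
        sum (colourDegree ψ) + (rowSums K (weight φ) + rowSums K (weight φ)) + blockSum K (weight φ)
          ≡⟨ cong₂ (λ t d → t + (d + d) + blockSum K (weight φ)) (copyColorSum-double ψ) (D-rowSums φ) ⟨
        S ψ + S ψ + (D φ + D φ) + blockSum K (weight φ)  ∎)
      where
      open ≡-Reasoning
      ψ : Fin n → Fin n
      ψ = φ ∘ transpose p q
      K : List (Fin n)
      K = p ∷ q ∷ []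
      K-unique : Unique K
      K-unique = (p≢q ∷ []) ∷ [] ∷ []
      S : (Fin n → Fin n) → ℕ
      S = copyColorSum G χ
      D : (Fin n → Fin n) → ℕ
      D φ′ = colourDegree φ′ p + colourDegree φ′ q
      D-rowSums : ∀ φ′ → D φ′ ≡ rowSums K (weight φ′)
      D-rowSums φ′ = cong (colourDegree φ′ p +_) (sym (+-identityʳ _))
      agree : ∀ i j → i ∉ K → j ∉ K → weight φ i j ≡ weight ψ i j
      agree i j i∉K j∉K = cong₂ (λ a b → if adj G i j then colour χ (φ a) (φ b) else 0)
                                (sym (fixed i∉K)) (sym (fixed j∉K))
        where
        fixed : ∀ {k} → k ∉ K → transpose p q k ≡ k
        fixed k∉K = transpose-fixes (k∉K ∘ here) (k∉K ∘ there ∘ here)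

    swapTrades-by-degrees : ∀ {p q} {new old : (Fin n → Fin n) → ℕ} → p ≢ q →
      (∀ φ → ∃ λ M → colourDegree (φ ∘ transpose p q) p + colourDegree (φ ∘ transpose p q) q ≡ new φ + M
                   × colourDegree φ p + colourDegree φ q ≡ old φ + M) →
      SwapTrades p q new old
    swapTrades-by-degrees {p} {q} {new} {old} p≢q degrees φ with degrees φ
    ... | M , after , before = +-cancelʳ-≡ M _ _ (begin
      S φ + new φ + M                  ≡⟨ +-assoc (S φ) (new φ) M ⟩
      S φ + (new φ + M)                ≡⟨ cong (S φ +_) after ⟨
      S φ + (D ψ p + D ψ q)            ≡⟨ colourSum-transpose φ p≢q ⟩
      S ψ + (D φ p + D φ q)            ≡⟨ cong (S ψ +_) before ⟩
      S ψ + (old φ + M)                ≡⟨ +-assoc (S ψ) (old φ) M ⟨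
      S ψ + old φ + M                  ∎)
      where
      open ≡-Reasoning
      S : (Fin n → Fin n) → ℕ
      S = copyColorSum G χ
      D : (Fin n → Fin n) → Fin n → ℕ
      D = colourDegree
      ψ : Fin n → Fin n
      ψ = φ ∘ transpose p q

    path-swapTrades : ∀ {v₁ v₂ v₃ v₄} → Distinct4 v₁ v₂ v₃ v₄ →
      Adj G v₁ v₂ → Adj G v₂ v₃ → Adj G v₃ v₄ → degree G v₂ ≡ 2 → degree G v₃ ≡ 2 →
      SwapTrades v₂ v₃ (λ φ → colourOf χ φ v₁ v₃ + colourOf χ φ v₂ v₄)
                       (λ φ → colourOf χ φ v₁ v₂ + colourOf χ φ v₃ v₄)
    path-swapTrades {v₁} {v₂} {v₃} {v₄} (v₁≢v₂ , v₁≢v₃ , _ , v₂≢v₃ , v₂≢v₄ , v₃≢v₄)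
      v₁~v₂ v₂~v₃ v₃~v₄ deg₂ deg₃ =
      swapTrades-by-degrees v₂≢v₃ (λ φ → colourOf χ φ v₂ v₃ + colourOf χ φ v₃ v₂ , after φ , before φ)
      where
      τ : Fin n → Fin n
      τ = transpose v₂ v₃
      N₂ : Neighbourhood G v₂ (v₁ ∷ v₃ ∷ [])
      N₂ = neighbourhood-by-degree G ((v₁≢v₃ ∷ []) ∷ [] ∷ []) (adj-sym G v₁~v₂ ∷ v₂~v₃ ∷ []) deg₂
      N₃ : Neighbourhood G v₃ (v₂ ∷ v₄ ∷ [])
      N₃ = neighbourhood-by-degree G ((v₂≢v₄ ∷ []) ∷ [] ∷ []) (adj-sym G v₂~v₃ ∷ v₃~v₄ ∷ []) deg₃
      shuffle : ∀ a b c d → a + (b + 0) + (c + (d + 0)) ≡ a + d + (b + c)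
      shuffle = solve 4 (λ a b c d → a :+ (b :+ con 0) :+ (c :+ (d :+ con 0)) := a :+ d :+ (b :+ c)) refl
      after : ∀ φ → let c = colourOf χ φ in
        colourDegree (φ ∘ τ) v₂ + colourDegree (φ ∘ τ) v₃ ≡ c v₁ v₃ + c v₂ v₄ + (c v₂ v₃ + c v₃ v₂)
      after φ = begin
        colourDegree (φ ∘ τ) v₂ + colourDegree (φ ∘ τ) v₃
          ≡⟨ cong₂ _+_ (colourDegree-neighbourhood (φ ∘ τ) N₂) (colourDegree-neighbourhood (φ ∘ τ) N₃) ⟩
        c (τ v₂) (τ v₁) + (c (τ v₂) (τ v₃) + 0) + (c (τ v₃) (τ v₂) + (c (τ v₃) (τ v₄) + 0))
          ≡⟨ evaluate ⟩
        c v₃ v₁ + (c v₃ v₂ + 0) + (c v₂ v₃ + (c v₂ v₄ + 0))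
          ≡⟨ shuffle (c v₃ v₁) (c v₃ v₂) (c v₂ v₃) (c v₂ v₄) ⟩
        c v₃ v₁ + c v₂ v₄ + (c v₃ v₂ + c v₂ v₃)
          ≡⟨ cong₂ (λ x y → x + c v₂ v₄ + y) (colour-sym χ-sym (φ v₃) (φ v₁))
                                               (+-comm (c v₃ v₂) (c v₂ v₃)) ⟩
        c v₁ v₃ + c v₂ v₄ + (c v₂ v₃ + c v₃ v₂) ∎
        where
        open ≡-Reasoning
        c : Fin n → Fin n → ℕ
        c = colourOf χ φ
        evaluate : c (τ v₂) (τ v₁) + (c (τ v₂) (τ v₃) + 0) + (c (τ v₃) (τ v₂) + (c (τ v₃) (τ v₄) + 0))
                 ≡ c v₃ v₁ + (c v₃ v₂ + 0) + (c v₂ v₃ + (c v₂ v₄ + 0))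
        evaluate rewrite transpose-left v₂ v₃ | transpose-right v₂ v₃
                       | transpose-fixes v₁≢v₂ v₁≢v₃ | transpose-fixes (v₂≢v₄ ∘ sym) (v₃≢v₄ ∘ sym) = refl
      before : ∀ φ → let c = colourOf χ φ in
        colourDegree φ v₂ + colourDegree φ v₃ ≡ c v₁ v₂ + c v₃ v₄ + (c v₂ v₃ + c v₃ v₂)
      before φ = begin
        colourDegree φ v₂ + colourDegree φ v₃
          ≡⟨ cong₂ _+_ (colourDegree-neighbourhood φ N₂) (colourDegree-neighbourhood φ N₃) ⟩
        c v₂ v₁ + (c v₂ v₃ + 0) + (c v₃ v₂ + (c v₃ v₄ + 0))
          ≡⟨ shuffle (c v₂ v₁) (c v₂ v₃) (c v₃ v₂) (c v₃ v₄) ⟩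
        c v₂ v₁ + c v₃ v₄ + (c v₂ v₃ + c v₃ v₂)
          ≡⟨ cong (λ x → x + c v₃ v₄ + (c v₂ v₃ + c v₃ v₂)) (colour-sym χ-sym (φ v₂) (φ v₁)) ⟩
        c v₁ v₂ + c v₃ v₄ + (c v₂ v₃ + c v₃ v₂) ∎
        where
        open ≡-Reasoning
        c : Fin n → Fin n → ℕ
        c = colourOf χ φ

    leaves-swapTrades : ∀ {v₁ v₂ v₃ v₄} → Distinct4 v₁ v₂ v₃ v₄ →
      ParentOfLeaf G v₁ v₂ → ParentOfLeaf G v₄ v₃ →
      SwapTrades v₂ v₃ (λ φ → colourOf χ φ v₁ v₃ + colourOf χ φ v₂ v₄)
                       (λ φ → colourOf χ φ v₁ v₂ + colourOf χ φ v₃ v₄)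
    leaves-swapTrades {v₁} {v₂} {v₃} {v₄} (v₁≢v₂ , v₁≢v₃ , _ , v₂≢v₃ , v₂≢v₄ , v₃≢v₄)
      (leaf₂ , v₁~v₂) (leaf₃ , v₄~v₃) =
      swapTrades-by-degrees v₂≢v₃ (λ φ → 0 , after φ , before φ)
      where
      τ : Fin n → Fin n
      τ = transpose v₂ v₃
      N₂ : Neighbourhood G v₂ (v₁ ∷ [])
      N₂ = leaf-neighbourhood G leaf₂ v₁~v₂
      N₃ : Neighbourhood G v₃ (v₄ ∷ [])
      N₃ = leaf-neighbourhood G leaf₃ v₄~v₃
      drop-zeros : ∀ a b → a + 0 + (b + 0) ≡ a + b + 0
      drop-zeros = solve 2 (λ a b → a :+ con 0 :+ (b :+ con 0) := a :+ b :+ con 0) refl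
      after : ∀ φ → let c = colourOf χ φ in
        colourDegree (φ ∘ τ) v₂ + colourDegree (φ ∘ τ) v₃ ≡ c v₁ v₃ + c v₂ v₄ + 0
      after φ = begin
        colourDegree (φ ∘ τ) v₂ + colourDegree (φ ∘ τ) v₃
          ≡⟨ cong₂ _+_ (colourDegree-neighbourhood (φ ∘ τ) N₂) (colourDegree-neighbourhood (φ ∘ τ) N₃) ⟩
        c (τ v₂) (τ v₁) + 0 + (c (τ v₃) (τ v₄) + 0)
          ≡⟨ evaluate ⟩
        c v₃ v₁ + 0 + (c v₂ v₄ + 0)
          ≡⟨ cong (λ x → x + 0 + (c v₂ v₄ + 0)) (colour-sym χ-sym (φ v₃) (φ v₁)) ⟩
        c v₁ v₃ + 0 + (c v₂ v₄ + 0)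
          ≡⟨ drop-zeros (c v₁ v₃) (c v₂ v₄) ⟩
        c v₁ v₃ + c v₂ v₄ + 0 ∎
        where
        open ≡-Reasoning
        c : Fin n → Fin n → ℕ
        c = colourOf χ φ
        evaluate : c (τ v₂) (τ v₁) + 0 + (c (τ v₃) (τ v₄) + 0) ≡ c v₃ v₁ + 0 + (c v₂ v₄ + 0)
        evaluate rewrite transpose-left v₂ v₃ | transpose-right v₂ v₃
                       | transpose-fixes v₁≢v₂ v₁≢v₃ | transpose-fixes (v₂≢v₄ ∘ sym) (v₃≢v₄ ∘ sym) = refl
      before : ∀ φ → let c = colourOf χ φ in
        colourDegree φ v₂ + colourDegree φ v₃ ≡ c v₁ v₂ + c v₃ v₄ + 0
      before φ = begin
        colourDegree φ v₂ + colourDegree φ v₃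
          ≡⟨ cong₂ _+_ (colourDegree-neighbourhood φ N₂) (colourDegree-neighbourhood φ N₃) ⟩
        c v₂ v₁ + 0 + (c v₃ v₄ + 0)
          ≡⟨ cong (λ x → x + 0 + (c v₃ v₄ + 0)) (colour-sym χ-sym (φ v₂) (φ v₁)) ⟩
        c v₁ v₂ + 0 + (c v₃ v₄ + 0)
          ≡⟨ drop-zeros (c v₁ v₂) (c v₃ v₄) ⟩
        c v₁ v₂ + c v₃ v₄ + 0 ∎
        where
        open ≡-Reasoning
        c : Fin n → Fin n → ℕ
        c = colourOf χ φ

    switching-swapTrades : ∀ {v₁ v₂ v₃ v₄} → SwitchingStructure G v₁ v₂ v₃ v₄ →
      SwapTrades v₂ v₃ (λ φ → colourOf χ φ v₁ v₃ + colourOf χ φ v₂ v₄)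
                       (λ φ → colourOf χ φ v₁ v₂ + colourOf χ φ v₃ v₄)
    switching-swapTrades (distinct , inj₁ (v₁~v₂ , v₂~v₃ , v₃~v₄ , deg₂ , deg₃)) =
      path-swapTrades distinct v₁~v₂ v₂~v₃ v₃~v₄ deg₂ deg₃
    switching-swapTrades (distinct , inj₂ (v₁v₂-leaf , v₄v₃-leaf)) =
      leaves-swapTrades distinct v₁v₂-leaf v₄v₃-leaf

    -- Covers both leaf sides: l adjacent to u (x = l, y = u) and l hanging from x (y = x).
    transposed-leaf-swapTrades : ∀ {u l x y O} → u ≢ l → Neighbourhood G u (x ∷ O) → Neighbourhood G l (y ∷ []) →
      transpose u l x ≡ y → transpose u l y ≡ x → All (λ o → transpose u l o ≡ o) O →
      SwapTrades u l (λ φ → sumOver O (colourOf χ φ l)) (λ φ → sumOver O (colourOf χ φ u))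
    transposed-leaf-swapTrades {u} {l} {x} {y} {O} u≢l N-u N-l τx≡y τy≡x O-fixed =
      swapTrades-by-degrees u≢l (λ φ → colourOf χ φ l y + colourOf χ φ u x , after φ , before φ)
      where
      τ : Fin n → Fin n
      τ = transpose u l
      after : ∀ φ → let c = colourOf χ φ in
        colourDegree (φ ∘ τ) u + colourDegree (φ ∘ τ) l ≡ sumOver O (c l) + (c l y + c u x)
      after φ = begin
        colourDegree (φ ∘ τ) u + colourDegree (φ ∘ τ) l
          ≡⟨ cong₂ _+_ (colourDegree-neighbourhood (φ ∘ τ) N-u) (colourDegree-neighbourhood (φ ∘ τ) N-l) ⟩
        c (τ u) (τ x) + sumOver O (colourOf χ (φ ∘ τ) u) + (c (τ l) (τ y) + 0)
          ≡⟨ cong₂ (λ a b → a + b + (c (τ l) (τ y) + 0)) (cong₂ c (transpose-left u l) τx≡y)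
                   (sumOver-transposed χ φ u (transpose-left u l) O-fixed) ⟩
        c l y + sumOver O (c l) + (c (τ l) (τ y) + 0)
          ≡⟨ cong (λ a → c l y + sumOver O (c l) + (a + 0)) (cong₂ c (transpose-right u l) τy≡x) ⟩
        c l y + sumOver O (c l) + (c u x + 0)
          ≡⟨ shape (c l y) (sumOver O (c l)) (c u x) ⟩
        sumOver O (c l) + (c l y + c u x) ∎
        where
        open ≡-Reasoning
        c : Fin n → Fin n → ℕ
        c = colourOf χ φ
        shape : ∀ a s b → a + s + (b + 0) ≡ s + (a + b)
        shape = solve 3 (λ a s b → a :+ s :+ (b :+ con 0) := s :+ (a :+ b)) refl
      before : ∀ φ → let c = colourOf χ φ in
        colourDegree φ u + colourDegree φ l ≡ sumOver O (c u) + (c l y + c u x)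
      before φ = begin
        colourDegree φ u + colourDegree φ l
          ≡⟨ cong₂ _+_ (colourDegree-neighbourhood φ N-u) (colourDegree-neighbourhood φ N-l) ⟩
        c u x + sumOver O (c u) + (c l y + 0)
          ≡⟨ shape (c u x) (sumOver O (c u)) (c l y) ⟩
        sumOver O (c u) + (c l y + c u x) ∎
        where
        open ≡-Reasoning
        c : Fin n → Fin n → ℕ
        c = colourOf χ φ
        shape : ∀ b s a → b + s + (a + 0) ≡ s + (a + b)
        shape = solve 3 (λ b s a → b :+ s :+ (a :+ con 0) := s :+ (a :+ b)) refl

    leafSwap-swapTrades : ∀ {u l O} → LeafSwap G u l O →
      SwapTrades u l (λ φ → sumOver O (colourOf χ φ l)) (λ φ → sumOver O (colourOf χ φ u))
    leafSwap-swapTrades {u} {l} {O}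
      record { u≢l = u≢l ; degree-u = deg ; adjacent = u~O ; unique = lO-unique@(l≢O ∷ _)
             ; leafSide = u~l , inj₁ (refl , leaf) } =
      transposed-leaf-swapTrades u≢l (neighbourhood-by-degree G lO-unique (u~l ∷ u~O) deg) (leaf-neighbourhood G leaf u~l)
        (transpose-right u l) (transpose-left u l) (fixes-O u~O l≢O)
      where
      fixes-O : All (Adj G u) O → All (l ≢_) O → All (λ o → transpose u l o ≡ o) O
      fixes-O u~O l≢O = All.zipWith (λ (u~o , l≢o) → transpose-fixes (adj⇒≢ G u~o ∘ sym) (l≢o ∘ sym)) (u~O , l≢O)
    leafSwap-swapTrades {u} {l} {O}
      record { via = x ; u≢l = u≢l ; degree-u = deg ; adjacent = u~O ; unique = xO-unique
             ; leafSide = u~x , inj₂ (leaf , x~l) } =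
      transposed-leaf-swapTrades u≢l (neighbourhood-by-degree G xO-unique (u~x ∷ u~O) deg) (leaf-neighbourhood G leaf x~l)
        x-fixed x-fixed (All.map (λ u~o → transpose-fixes (adj⇒≢ G u~o ∘ sym) (o≢l u~o)) u~O)
      where
      x-fixed : transpose u l x ≡ x
      x-fixed = transpose-fixes (adj⇒≢ G u~x ∘ sym) (adj⇒≢ G x~l)
      o≢l : ∀ {o} → Adj G u o → o ≢ l
      o≢l u~o refl = adj⇒≢ G u~x (leaf-parent G leaf x~l (adj-sym G u~o))

    zeroSumCopy-by-placement : ∀ {v₁ v₂ v₃ v₄} → SwitchingStructure G v₁ v₂ v₃ v₄ →
      ∀ {u l O} → LeafSwap G u l O → All (λ z → z ≢ v₂ × z ≢ v₃) (l ∷ u ∷ O) →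
      ∀ {φ} → Injective _≡_ _≡_ φ →
      ∀ {X P Q Y} → φ v₁ ≡ X → φ v₂ ≡ P → φ v₃ ≡ Q → φ v₄ ≡ Y → AlternatingSums χ X P Y Q →
      ∀ {s t Os} → φ l ≡ s → φ u ≡ t → map φ O ≡ Os →
      ¬ sumOver Os (colour χ s) ≡₃ sumOver Os (colour χ t) → HasZeroSumCopy G χ
    zeroSumCopy-by-placement {v₁} {v₂} {v₃} {v₄} S {u} {l} {O} L (l-avoids ∷ u-avoids ∷ O-avoids) {φ} φ-injective
      refl refl refl refl alternating refl refl refl leaf-sums =
      zeroSumCopy-from-swaps (switching-swapTrades S) (leafSwap-swapTrades L) φ-injective
        (sumOver-transposed χ φ l (fixed l-avoids) (All.map fixed O-avoids))
        (sumOver-transposed χ φ u (fixed u-avoids) (All.map fixed O-avoids))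
        switch-sums
        (subst₂ (λ a b → ¬ a ≡₃ b) (sym (sumOver-map (colour χ (φ l)) φ O))
                                   (sym (sumOver-map (colour χ (φ u)) φ O)) leaf-sums)
      where
      fixed : ∀ {z} → z ≢ v₂ × z ≢ v₃ → transpose v₂ v₃ z ≡ z
      fixed (z≢v₂ , z≢v₃) = transpose-fixes z≢v₂ z≢v₃
      k : Fin n → Fin n → ℕ
      k = colour χ
      switch-sums :
        ¬ colourOf χ φ v₁ v₃ + colourOf χ φ v₂ v₄ ≡₃ colourOf χ φ v₁ v₂ + colourOf χ φ v₃ v₄
      switch-sums e = alternating (begin
        k X P + k Y Q   ≡⟨ cong (k X P +_) (colour-sym χ-sym Y Q) ⟩
        k X P + k Q Y   ≈⟨ e ⟨
        k X Q + k P Y   ≡⟨ +-comm (k X Q) (k P Y) ⟩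
        k P Y + k X Q   ≡⟨ cong (k P Y +_) (colour-sym χ-sym X Q) ⟩
        k P Y + k Q X   ∎)
        where
        open ≡₃-Reasoning
        X P Q Y : Fin n
        X = φ v₁
        P = φ v₂
        Q = φ v₃
        Y = φ v₄

    zeroSumCopy-off-cycle : ∀ {v₁ v₂ v₃ v₄} → SwitchingStructure G v₁ v₂ v₃ v₄ →
      ∀ {u l} (ps : List (Fin n × Fin n)) → LeafSwap G u l (map proj₁ ps) →
      Unique (l ∷ u ∷ map proj₁ ps) → All (_∉ (v₁ ∷ v₂ ∷ v₃ ∷ v₄ ∷ [])) (l ∷ u ∷ map proj₁ ps) →
      ∀ {a b c d} → Distinct4 a b c d → AlternatingSums χ a b c d →
      ∀ {s t} → Unique (s ∷ t ∷ map proj₂ ps) → All (_∉ (a ∷ b ∷ c ∷ d ∷ [])) (s ∷ t ∷ map proj₂ ps) →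
      ¬ sumOver (map proj₂ ps) (colour χ s) ≡₃ sumOver (map proj₂ ps) (colour χ t) → HasZeroSumCopy G χ
    zeroSumCopy-off-cycle {v₁} {v₂} {v₃} {v₄} S {u} {l} ps L dom-unique dom-outside {a} {b} {c} {d}
      abcd-distinct alternating {s} {t} cod-unique cod-outside leaf-sums
      with extend-injection ((l , s) ∷ (u , t) ∷ ps ++ cycle) domain codomain
      where
      cycle : List (Fin n × Fin n)
      cycle = (v₁ , a) ∷ (v₂ , b) ∷ (v₃ , d) ∷ (v₄ , c) ∷ []
      domain : Unique (map proj₁ ((l , s) ∷ (u , t) ∷ ps ++ cycle))
      domain = subst (λ xs → Unique (l ∷ u ∷ xs)) (sym (map-++ proj₁ ps cycle))
                     (unique-++-quadruple dom-unique dom-outside (proj₁ S))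
      codomain : Unique (map proj₂ ((l , s) ∷ (u , t) ∷ ps ++ cycle))
      codomain = subst (λ xs → Unique (s ∷ t ∷ xs)) (sym (map-++ proj₂ ps cycle))
                       (unique-++-cycle cod-unique cod-outside abcd-distinct)
    ... | φ , φ-injective , (φl ∷ φu ∷ φ-maps) with ++⁻ ps φ-maps
    ...   | φ-ps , (φv₁ ∷ φv₂ ∷ φv₃ ∷ φv₄ ∷ []) =
      zeroSumCopy-by-placement S L (All.map avoids-inner dom-outside) φ-injective
        φv₁ φv₂ φv₃ φv₄ alternating φl φu (map-pairs φ-ps) leaf-sums
      where
      map-pairs : ∀ {qs} → All (λ (i , j) → φ i ≡ j) qs → map φ (map proj₁ qs) ≡ map proj₂ qs
      map-pairs []       = refl
      map-pairs (e ∷ es) = cong₂ _∷_ e (map-pairs es)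

    case₁-at-end : ∀ {v₁ v₂ v₃ v₄} → SwitchingStructure G v₁ v₂ v₃ v₄ →
      ∀ {u l} → LeafSwap G u l (v₁ ∷ []) → All (_∉ (v₁ ∷ v₂ ∷ v₃ ∷ v₄ ∷ [])) (l ∷ u ∷ []) →
      ∀ {a b c d} → Distinct4 a b c d → AlternatingSums χ a b c d → BicolouredCherry χ (a ∷ b ∷ c ∷ d ∷ []) →
      HasZeroSumCopy G χ
    case₁-at-end {v₁} {v₂} {v₃} {v₄} S {u} {l} L outside@(l∉ ∷ u∉ ∷ [])
      {a} {b} {c} {d} (a≢b , a≢c , a≢d , b≢c , b≢d , c≢d) alternating
      (cherry y s t ((s≢t ∷ s≢y ∷ []) ∷ (t≢y ∷ []) ∷ [] ∷ []) (s∉ ∷ t∉ ∷ y∉ ∷ []) bicoloured) =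
      [ through-abc , through-cda ] (alternating-through χ-sym alternating y)
      where
      C : List (Fin n)
      C = a ∷ b ∷ c ∷ d ∷ []
      a∈ : a ∈ C
      a∈ = here refl
      b∈ : b ∈ C
      b∈ = there (here refl)
      c∈ : c ∈ C
      c∈ = there (there (here refl))
      d∈ : d ∈ C
      d∈ = there (there (there (here refl)))
      y≢ : ∀ {z} → z ∈ C → y ≢ z
      y≢ z∈C refl = y∉ z∈C
      place : ∀ {P Y Q} → AlternatingSums χ y P Y Q → Unique (y ∷ P ∷ Q ∷ Y ∷ []) →
        All (_∈ (y ∷ C)) (y ∷ P ∷ Q ∷ Y ∷ []) → HasZeroSumCopy G χ
      place {P} {Y} {Q} alt cycle-unique cycle-inside
        with extend-injection ((l , s) ∷ (u , t) ∷ (v₁ , y) ∷ (v₂ , P) ∷ (v₃ , Q) ∷ (v₄ , Y) ∷ [])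
                              domain codomain
        where
        domain : Unique (l ∷ u ∷ v₁ ∷ v₂ ∷ v₃ ∷ v₄ ∷ [])
        domain = unique-++-quadruple ((LeafSwap.u≢l L ∘ sym ∷ []) ∷ [] ∷ []) outside (proj₁ S)
        codomain : Unique (s ∷ t ∷ y ∷ P ∷ Q ∷ Y ∷ [])
        codomain = unique-++ ((s≢t ∷ []) ∷ [] ∷ []) cycle-unique
                             (∉-∷⁺ s≢y s∉ ∷ ∉-∷⁺ t≢y t∉ ∷ []) cycle-inside
      ... | φ , φ-injective , (φl ∷ φu ∷ φv₁ ∷ φv₂ ∷ φv₃ ∷ φv₄ ∷ []) =
        zeroSumCopy-by-placement S L (avoids-inner l∉ ∷ avoids-inner u∉ ∷ v₁-avoids ∷ []) φ-injective
          φv₁ φv₂ φv₃ φv₄ alt φl φu (cong (_∷ []) φv₁) (bicoloured⇒single-sums-differ χ-sym bicoloured)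
        where
        v₁-avoids : v₁ ≢ v₂ × v₁ ≢ v₃
        v₁-avoids = proj₁ (proj₁ S) , proj₁ (proj₂ (proj₁ S))
      through-abc : AlternatingSums χ y a b c → HasZeroSumCopy G χ
      through-abc alt =
        place alt ((y≢ a∈ ∷ y≢ c∈ ∷ y≢ b∈ ∷ []) ∷ (a≢c ∷ a≢b ∷ []) ∷ (b≢c ∘ sym ∷ []) ∷ [] ∷ [])
                  (here refl ∷ there a∈ ∷ there c∈ ∷ there b∈ ∷ [])
      through-cda : AlternatingSums χ y c d a → HasZeroSumCopy G χ
      through-cda alt =
        place alt ((y≢ c∈ ∷ y≢ a∈ ∷ y≢ d∈ ∷ []) ∷ (a≢c ∘ sym ∷ c≢d ∷ []) ∷ (a≢d ∷ []) ∷ [] ∷ [])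
                  (here refl ∷ there c∈ ∷ there a∈ ∷ there d∈ ∷ [])

    -- v is mapped to the centre of the cherry; when v is an end of the switching structure we
    -- use an alternating cycle through that centre instead, reversing the structure if v = v₄.
    case₁ : HasCase1 G → ∀ {a b c d} → Distinct4 a b c d → AlternatingSums χ a b c d →
      BicolouredCherry χ (a ∷ b ∷ c ∷ d ∷ []) → HasZeroSumCopy G χ
    case₁ (v₁ , v₂ , v₃ , v₄ , l , u , S , (deg , v , x , x≢v , u~v , leafSide) , l-out , u-out)
      abcd-distinct alternating outside-cherry with v ≟ v₁ | v ≟ v₄
    ... | yes refl | _        =
      case₁-at-end S (leafSwap₂ G deg x≢v u~v leafSide) (NotIn4⇒∉ l-out ∷ NotIn4⇒∉ u-out ∷ [])
        abcd-distinct alternating outside-cherry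
    ... | no _     | yes refl =
      case₁-at-end (switching-reverse G S) (leafSwap₂ G deg x≢v u~v leafSide)
        (NotIn4⇒∉ (NotIn4-reverse l-out) ∷ NotIn4⇒∉ (NotIn4-reverse u-out) ∷ [])
        abcd-distinct alternating outside-cherry
    ... | no v≢v₁  | no v≢v₄  with outside-cherry
    ...   | cherry y s t sty-distinct sty-outside bicoloured =
      zeroSumCopy-off-cycle S ((v , y) ∷ []) L
        ((LeafSwap.u≢l L ∘ sym ∷ v≢l ∘ sym ∷ []) ∷ (adj⇒≢ G u~v ∷ []) ∷ [] ∷ [])
        (NotIn4⇒∉ l-out ∷ NotIn4⇒∉ u-out ∷ NotIn4⇒∉ (v≢v₁ , proj₁ v-inner , proj₂ v-inner , v≢v₄) ∷ [])
        abcd-distinct alternating sty-distinct sty-outside (bicoloured⇒single-sums-differ χ-sym bicoloured)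
      where
      L : LeafSwap G u l (v ∷ [])
      L = leafSwap₂ G deg x≢v u~v leafSide
      v≢l : v ≢ l
      v≢l = proj₂ (leafSide-distinct G leafSide u~v x≢v)
      v-inner : v ≢ v₂ × v ≢ v₃
      v-inner = outside-neighbour-avoids-inner G S (NotIn4⇒∉ u-out) u~v

    -- v and w are mapped to two of the three vertices y (the centre of the cherry), p and q (fresh).
    case₂ : HasCase2 G → n ≥ 9 → ∀ {a b c d} → Distinct4 a b c d → AlternatingSums χ a b c d →
      BicolouredCherry χ (a ∷ b ∷ c ∷ d ∷ []) → HasZeroSumCopy G χ
    case₂ (v₁ , v₂ , v₃ , v₄ , l , u , v , w , S , (deg , u~v , u~w , v≢w , x , x≢v , x≢w , leafSide) ,
           l-out , u-out , v-out , w-out)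
      n≥9 {a} {b} {c} {d} abcd-distinct alternating
      (cherry y s t ((s≢t ∷ s≢y ∷ []) ∷ (t≢y ∷ []) ∷ [] ∷ []) (s∉ ∷ t∉ ∷ y∉ ∷ []) bicoloured)
      with fresh-vertex (s ∷ t ∷ y ∷ a ∷ b ∷ c ∷ d ∷ []) (≤-trans (n≤1+n 8) n≥9)
    ... | p , p∉ with fresh-vertex (p ∷ s ∷ t ∷ y ∷ a ∷ b ∷ c ∷ d ∷ []) n≥9
    ... | q , q∉ =
      [ place (s≢t ∷ s≢y ∷ s≢p ∷ []) (t≢y ∷ t≢p ∷ []) y≢p y∉ p∉C
      , [ place (s≢t ∷ s≢y ∷ s≢q ∷ []) (t≢y ∷ t≢q ∷ []) y≢q y∉ q∉C
        , place (s≢t ∷ s≢p ∷ s≢q ∷ []) (t≢p ∷ t≢q ∷ []) p≢q p∉C q∉C ] ]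
      (pair-with-unequal-sums (colour χ s) (colour χ t) {y} {p} {q} σy≢τy)
      where
      C : List (Fin n)
      C = a ∷ b ∷ c ∷ d ∷ []
      s≢p : s ≢ p
      s≢p refl = p∉ (here refl)
      t≢p : t ≢ p
      t≢p refl = p∉ (there (here refl))
      y≢p : y ≢ p
      y≢p refl = p∉ (there (there (here refl)))
      p∉C : p ∉ C
      p∉C = p∉ ∘ there ∘ there ∘ there
      p≢q : p ≢ q
      p≢q refl = q∉ (here refl)
      s≢q : s ≢ q
      s≢q refl = q∉ (there (here refl))
      t≢q : t ≢ q
      t≢q refl = q∉ (there (there (here refl)))
      y≢q : y ≢ q
      y≢q refl = q∉ (there (there (there (here refl))))
      q∉C : q ∉ C
      q∉C = q∉ ∘ there ∘ there ∘ there ∘ there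
      σy≢τy : ¬ colour χ s y ≡₃ colour χ t y
      σy≢τy e = bicoloured (trans (χ-sym y s) (trans (toℕ-≡₃-injective e) (χ-sym t y)))
      L : LeafSwap G u l (v ∷ w ∷ [])
      L = leafSwap₃ G deg u~v u~w v≢w x≢v x≢w leafSide
      l≢ : ∀ {o} → Adj G u o → x ≢ o → l ≢ o
      l≢ u~o x≢o = proj₂ (leafSide-distinct G leafSide u~o x≢o) ∘ sym
      place : ∀ {V W} → All (s ≢_) (t ∷ V ∷ W ∷ []) → All (t ≢_) (V ∷ W ∷ []) → V ≢ W →
        V ∉ C → W ∉ C → ¬ sumOver (V ∷ W ∷ []) (colour χ s) ≡₃ sumOver (V ∷ W ∷ []) (colour χ t) →
        HasZeroSumCopy G χ
      place {V} {W} s≢ t≢ V≢W V∉C W∉C =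
        zeroSumCopy-off-cycle S ((v , V) ∷ (w , W) ∷ []) L
          ((LeafSwap.u≢l L ∘ sym ∷ l≢ u~v x≢v ∷ l≢ u~w x≢w ∷ []) ∷ (adj⇒≢ G u~v ∷ adj⇒≢ G u~w ∷ [])
            ∷ (v≢w ∷ []) ∷ [] ∷ [])
          (NotIn4⇒∉ l-out ∷ NotIn4⇒∉ u-out ∷ NotIn4⇒∉ v-out ∷ NotIn4⇒∉ w-out ∷ [])
          abcd-distinct alternating (s≢ ∷ t≢ ∷ (V≢W ∷ []) ∷ [] ∷ []) (s∉ ∷ t∉ ∷ V∉C ∷ W∉C ∷ [])

proposition4p17 : (n : ℕ) (F : Graph n) → IsForest F → 3 ∣ edgeCount F
    → ((n ≥ 7 × HasCase1 F) ⊎ (n ≥ 9 × HasCase2 F))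
    → (χ : Coloring n) → SymColoring χ → AlphaC4≥1 χ
    → (∃[ a ] ∃[ b ] ∃[ c ] ∃[ d ] (Alternating χ a b c d × NotMonoOutside χ a b c d))
    → HasZeroSumCopy F χ
proposition4p17 n F _ _ structures χ χ-sym _ (a , b , c , d , (abcd-distinct , alternating) , not-mono) =
  [ (λ (_ , case₁-structures) → case₁ F χ χ-sym case₁-structures abcd-distinct alternating′ outside-cherry)
  , (λ (n≥9 , case₂-structures) → case₂ F χ χ-sym case₂-structures n≥9 abcd-distinct alternating′ outside-cherry)
  ] structures
  where
  alternating′ : AlternatingSums χ a b c d
  alternating′ = alternating ∘ residues
  outside-cherry : BicolouredCherry χ (a ∷ b ∷ c ∷ d ∷ [])
  outside-cherry = NotMonoOutside⇒cherry χ-sym not-mono
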